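{- Let $G$ be a finite simple graph on $n$ vertices. Then \[ \sum_{v\in V(G)} d(v)\cdot\frac{\mathrm{cl}(v) - 1}{\mathrm{cl}(v)} \leq \Bigg(\sum_{v\in V(G)} \frac{\mathrm{cl}(v) - 1}{\mathrm{cl}(v)}\Bigg)^2. \] Equality holds if and only if $G$ is, up to isolated vertices, a complete regular multi-partite graph.
   Context: $d(v)$ is the degree of $v$; $\mathrm{cl}(v)$ denotes the order of a largest clique of $G$ containing the vertex $v$ (so $\mathrm{cl}(v)=1$ for an isolated vertex). -}

module Defs where

open import Data.Nat as ℕ using (ℕ; zero; suc)
open import Data.Bool using (Bool; true; false; if_then_else_)
open import Data.Fin using (Fin; zero; suc)
open import Data.Fin.Subset using (Subset; _∈_; ∣_∣)
open import Data.Integer using (+_)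
open import Data.Rational using (ℚ; 0ℚ; _/_; _+_)
open import Data.Product using (Σ; ∃; _×_)
open import Relation.Binary.PropositionalEquality using (_≡_; _≢_)
open import Function.Bundles using (_⇔_)

record Graph (n : ℕ) : Set where
  field
    adj    : Fin n → Fin n → Bool
    sym    : ∀ u v → adj u v ≡ adj v u
    irrefl : ∀ v → adj v v ≡ false
open Graph public

sumℕ : ∀ {n} → (Fin n → ℕ) → ℕ
sumℕ {zero}  f = 0
sumℕ {suc n} f = f zero ℕ.+ sumℕ (λ i → f (suc i))

sumℚ : ∀ {n} → (Fin n → ℚ) → ℚ
sumℚ {zero}  f = 0ℚ
sumℚ {suc n} f = f zero + sumℚ (λ i → f (suc i))

degree : ∀ {n} → Graph n → Fin n → ℕ
degree G v = sumℕ (λ u → if adj G v u then 1 else 0)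

IsClique : ∀ {n} → Graph n → Subset n → Set
IsClique G S = ∀ u w → u ∈ S → w ∈ S → u ≢ w → adj G u w ≡ true

IsCl : ∀ {n} → Graph n → Fin n → ℕ → Set
IsCl G v k =
  (Σ (Subset _) λ S → IsClique G S × v ∈ S × ∣ S ∣ ≡ k)
  × (∀ S → IsClique G S → v ∈ S → ∣ S ∣ ℕ.≤ k)

-- (k - 1) / k as a rational (k = 0 never occurs for k = cl(v) ≥ 1;
-- it is sent to 0 only to make the function total).
ratio : ℕ → ℚ
ratio zero    = 0ℚ
ratio (suc k) = + k / suc k

toℚ : ℕ → ℚ
toℚ m = + m / 1

NonIsolated : ∀ {n} → Graph n → Fin n → Set
NonIsolated G v = 0 ℕ.< degree G v

-- G is, up to isolated vertices, a complete regular multipartite graph: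
-- the subgraph induced on the non-isolated vertices is complete
-- multipartite (two such vertices are adjacent iff they lie in different
-- parts) and regular (all its vertices have the same degree; degrees in
-- this subgraph equal degrees in G since isolated vertices have no edges).
CompleteRegularMultipartiteUpToIsolated : ∀ {n} → Graph n → Set
CompleteRegularMultipartiteUpToIsolated {n} G =
  Σ ℕ λ k → Σ (Fin n → Fin k) λ part →
    (∀ u v → NonIsolated G u → NonIsolated G v →
       (adj G u v ≡ true) ⇔ (part u ≢ part v))
    × (∀ u v → NonIsolated G u → NonIsolated G v →
         degree G u ≡ degree G v)

-- Write a v = (cl v - 1) / cl v and, for a vertex set U, excess U = (Σ_{v ∈ U} a v)² - Σ_{v ∈ U} a v · d_U(v).
-- Removing a maximal clique K of U, with P = U ∖ K, splits excess U into excess P, excess K and one cross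
-- term for each u ∈ P.  Every vertex of K lies in a clique of size |K|, so a ≥ (|K| - 1) / |K| on K and
-- excess K ≥ 0; each cross term is non-negative by an elementary inequality in the numbers e and f ≥ 1 of
-- neighbours and non-neighbours of u in K.  Induction on |U| gives excess ≥ 0.  When the excess vanishes
-- all three parts do, which forces non-adjacency to be transitive and degrees to be equal on the vertices
-- with a v > 0, i.e. the non-isolated ones.  Conversely, in a regular complete multipartite graph every
-- non-isolated vertex misses exactly one vertex of a maximal clique, and double counting gives excess = 0.

module Submission where

open import Defs hiding (sym)
open import Data.Nat using (ℕ)
open import Data.Fin using (Fin)
open import Data.Rational using (_≤_; _*_)
open import Data.Product using (_×_)
open import Relation.Binary.PropositionalEquality using (_≡_)
open import Function.Bundles using (_⇔_)

open import Algebra.Bundles using (Ring)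
open import Data.Bool using (Bool; true; false; if_then_else_; _∧_; _∨_; not)
import Data.Bool.Properties as Bool
open import Data.Bool.Properties using (∨-zeroʳ; ∨-identityʳ; ∧-conicalˡ; ∧-conicalʳ; not-injective)
open import Data.Fin using (zero; suc)
import Data.Fin.Properties as Fin
open import Data.Fin.Subset using (Subset; _∈_; ∣_∣)
import Data.Integer as ℤ
import Data.Integer.Properties as ℤ
import Data.Integer.Tactic.RingSolver as ℤ-Solver
open import Data.Maybe as Maybe using (Maybe; just; nothing)
open import Data.Nat as ℕ using (zero; suc; z≤n; s≤s)
import Data.Nat.Properties as ℕ
open import Data.Product using (_,_; ∃; proj₁; proj₂)
open import Data.Rational using (ℚ; 0ℚ; 1ℚ; _+_; _-_; -_; _<_; fromℚᵘ; toℚᵘ; positive; nonNegative)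
open import Data.Rational.Properties
import Data.Rational.Unnormalised as ℚᵘ
import Data.Rational.Unnormalised.Properties as ℚᵘ
open import Data.Sum using (_⊎_; inj₁; inj₂)
open import Data.Vec using ([]; _∷_; lookup; tabulate)
import Data.Vec.Properties as Vec
open import Function using (_∘_)
open import Function.Bundles using (mk⇔; Equivalence)
open import Relation.Binary.PropositionalEquality using (refl; sym; trans; cong; cong₂; subst; subst₂; _≢_; module ≡-Reasoning)
open import Relation.Nullary using (Dec; yes; no; ¬_; contradiction)
open import Relation.Nullary.Decidable using (does; dec-true; dec-false; _×-dec_; _→-dec_; ¬?; dec⇒maybe)
open import Algebra.Properties.Group +-0-group using (x∙y⁻¹≈ε⇒x≈y)
open import Algebra.Properties.Semiring.Sum (Ring.semiring +-*-ring)
  using (sum; sum-cong-≗; sum-replicate-zero; ∑-distrib-+; ∑-comm; *-distribˡ-sum; *-distribʳ-sum)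
open import Tactic.RingSolver using (solve-∀)
open import Tactic.RingSolver.Core.AlmostCommutativeRing using (AlmostCommutativeRing; fromCommutativeRing)

-- Arithmetic of ℚ

ℚ-ring : AlmostCommutativeRing _ _
ℚ-ring = fromCommutativeRing +-*-commutativeRing (λ p → dec⇒maybe (0ℚ ≟ p))

p≤q⇒0≤q-p : ∀ {p q} → p ≤ q → 0ℚ ≤ q - p
p≤q⇒0≤q-p {p} {q} p≤q = subst (_≤ q - p) (+-inverseʳ p) (+-monoˡ-≤ (- p) p≤q)

p<q⇒0<q-p : ∀ {p q} → p < q → 0ℚ < q - p
p<q⇒0<q-p {p} {q} p<q = subst (_< q - p) (+-inverseʳ p) (+-mono-<-≤ p<q (≤-refl { - p}))

private
  p+[q-p]≡q : ∀ p q → p + (q - p) ≡ q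
  p+[q-p]≡q = solve-∀ ℚ-ring

0≤q-p⇒p≤q : ∀ {p q} → 0ℚ ≤ q - p → p ≤ q
0≤q-p⇒p≤q {p} {q} 0≤q-p = subst₂ _≤_ (+-identityʳ p) (p+[q-p]≡q p q) (+-monoʳ-≤ p 0≤q-p)

0<q-p⇒p<q : ∀ {p q} → 0ℚ < q - p → p < q
0<q-p⇒p<q {p} {q} 0<q-p = subst₂ _<_ (+-identityʳ p) (p+[q-p]≡q p q) (+-mono-≤-< (≤-refl {p}) 0<q-p)

p-q≡0⇒p≡q : ∀ {p q} → p - q ≡ 0ℚ → p ≡ q
p-q≡0⇒p≡q {p} {q} = x∙y⁻¹≈ε⇒x≈y p q

*-nonNeg : ∀ {p q} → 0ℚ ≤ p → 0ℚ ≤ q → 0ℚ ≤ p * q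
*-nonNeg {p} {q} 0≤p 0≤q = subst (_≤ p * q) (*-zeroʳ p) (*-monoˡ-≤-nonNeg p {{nonNegative 0≤p}} 0≤q)

*-pos : ∀ {p q} → 0ℚ < p → 0ℚ < q → 0ℚ < p * q
*-pos {p} {q} 0<p 0<q = subst (_< p * q) (*-zeroʳ p) (*-monoʳ-<-pos p {{positive 0<p}} 0<q)

0≤p*q⇒0≤q : ∀ {p q} → 0ℚ < p → 0ℚ ≤ p * q → 0ℚ ≤ q
0≤p*q⇒0≤q {p} {q} 0<p 0≤pq = *-cancelˡ-≤-pos p {{positive 0<p}} (subst (_≤ p * q) (sym (*-zeroʳ p)) 0≤pq)

0<p*q⇒0<q : ∀ {p q} → 0ℚ < p → 0ℚ < p * q → 0ℚ < q
0<p*q⇒0<q {p} {q} 0<p 0<pq with 0ℚ <? q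
... | yes 0<q = 0<q
... | no 0≮q = contradiction (<-≤-trans 0<pq pq≤0) (<-irrefl refl)
  where pq≤0 = subst (p * q ≤_) (*-zeroʳ p) (*-monoˡ-≤-nonNeg p {{nonNegative (<⇒≤ 0<p)}} (≮⇒≥ 0≮q))

p*q≡0⇒q≡0 : ∀ {p q} → 0ℚ < p → p * q ≡ 0ℚ → q ≡ 0ℚ
p*q≡0⇒q≡0 {p} {q} 0<p pq≡0 = ≤-antisym
  (*-cancelˡ-≤-pos p {{positive 0<p}} (subst (p * q ≤_) (sym (*-zeroʳ p)) (≤-reflexive pq≡0)))
  (0≤p*q⇒0≤q 0<p (≤-reflexive (sym pq≡0)))

p+q≡0⇒p≡0 : ∀ {p q} → 0ℚ ≤ p → 0ℚ ≤ q → p + q ≡ 0ℚ → p ≡ 0ℚ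
p+q≡0⇒p≡0 {p} {q} 0≤p 0≤q p+q≡0 = ≤-antisym (subst₂ _≤_ (+-identityʳ p) p+q≡0 (+-monoʳ-≤ p 0≤q)) 0≤p

p+q≡0⇒q≡0 : ∀ {p q} → 0ℚ ≤ p → 0ℚ ≤ q → p + q ≡ 0ℚ → q ≡ 0ℚ
p+q≡0⇒q≡0 {p} {q} 0≤p 0≤q p+q≡0 = p+q≡0⇒p≡0 0≤q 0≤p (trans (+-comm q p) p+q≡0)

fromℚᵘ-homo-+ : ∀ p q → fromℚᵘ (p ℚᵘ.+ q) ≡ fromℚᵘ p + fromℚᵘ q
fromℚᵘ-homo-+ p q = begin
  fromℚᵘ (p ℚᵘ.+ q)                  ≡⟨ fromℚᵘ-cong (ℚᵘ.+-cong (ℚᵘ.≃-sym (toℚᵘ-fromℚᵘ p)) (ℚᵘ.≃-sym (toℚᵘ-fromℚᵘ q))) ⟩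
  fromℚᵘ (toℚᵘ p′ ℚᵘ.+ toℚᵘ q′)      ≡⟨ fromℚᵘ-cong (ℚᵘ.≃-sym (toℚᵘ-homo-+ p′ q′)) ⟩
  fromℚᵘ (toℚᵘ (p′ + q′))            ≡⟨ fromℚᵘ-toℚᵘ (p′ + q′) ⟩
  p′ + q′                            ∎
  where
  open ≡-Reasoning
  p′ = fromℚᵘ p
  q′ = fromℚᵘ q

fromℚᵘ-homo-* : ∀ p q → fromℚᵘ (p ℚᵘ.* q) ≡ fromℚᵘ p * fromℚᵘ q
fromℚᵘ-homo-* p q = begin
  fromℚᵘ (p ℚᵘ.* q)                  ≡⟨ fromℚᵘ-cong (ℚᵘ.*-cong (ℚᵘ.≃-sym (toℚᵘ-fromℚᵘ p)) (ℚᵘ.≃-sym (toℚᵘ-fromℚᵘ q))) ⟩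
  fromℚᵘ (toℚᵘ p′ ℚᵘ.* toℚᵘ q′)      ≡⟨ fromℚᵘ-cong (ℚᵘ.≃-sym (toℚᵘ-homo-* p′ q′)) ⟩
  fromℚᵘ (toℚᵘ (p′ * q′))            ≡⟨ fromℚᵘ-toℚᵘ (p′ * q′) ⟩
  p′ * q′                            ∎
  where
  open ≡-Reasoning
  p′ = fromℚᵘ p
  q′ = fromℚᵘ q

-- By the definition of _/_, toℚ m is fromℚᵘ (mkℚᵘ (+ m) 0) and ratio (suc k) is fromℚᵘ (mkℚᵘ (+ k) k).
toℚ-+ : ∀ m k → toℚ (m ℕ.+ k) ≡ toℚ m + toℚ k
toℚ-+ m k = trans (fromℚᵘ-cong {ℚᵘ.mkℚᵘ (ℤ.+ (m ℕ.+ k)) 0} {m′ ℚᵘ.+ k′} (ℚᵘ.*≡* cross)) (fromℚᵘ-homo-+ m′ k′)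
  where
  m′ = ℚᵘ.mkℚᵘ (ℤ.+ m) 0
  k′ = ℚᵘ.mkℚᵘ (ℤ.+ k) 0
  cross : ℤ.+ (m ℕ.+ k) ℤ.* ℤ.+ 1 ≡ (ℤ.+ m ℤ.* ℤ.+ 1 ℤ.+ ℤ.+ k ℤ.* ℤ.+ 1) ℤ.* ℤ.+ 1
  cross = trans (cong (ℤ._* ℤ.+ 1) (ℤ.pos-+ m k)) (identity (ℤ.+ m) (ℤ.+ k))
    where identity : ∀ a b → (a ℤ.+ b) ℤ.* ℤ.+ 1 ≡ (a ℤ.* ℤ.+ 1 ℤ.+ b ℤ.* ℤ.+ 1) ℤ.* ℤ.+ 1
          identity = ℤ-Solver.solve-∀

toℚ-suc : ∀ m → toℚ (suc m) ≡ 1ℚ + toℚ m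
toℚ-suc = toℚ-+ 1

0≤toℚ : ∀ m → 0ℚ ≤ toℚ m
0≤toℚ m = nonNegative⁻¹ (toℚ m) {{normalize-nonNeg m 1}}

0<toℚ : ∀ m → 0ℚ < toℚ (suc m)
0<toℚ m = positive⁻¹ (toℚ (suc m)) {{normalize-pos (suc m) 1}}

toℚ-mono-≤ : ∀ {m k} → m ℕ.≤ k → toℚ m ≤ toℚ k
toℚ-mono-≤ {m} {k} m≤k = subst₂ _≤_ (+-identityʳ (toℚ m)) toℚ[m+[k∸m]]
  (+-monoʳ-≤ (toℚ m) (0≤toℚ (k ℕ.∸ m)))
  where toℚ[m+[k∸m]] = trans (sym (toℚ-+ m (k ℕ.∸ m))) (cong toℚ (ℕ.m+[n∸m]≡n m≤k))

toℚ-mono-< : ∀ {m k} → m ℕ.< k → toℚ m < toℚ k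
toℚ-mono-< {m} {suc k} (s≤s m≤k) = subst₂ _<_ (+-identityˡ (toℚ m)) (sym (toℚ-suc k))
  (+-mono-<-≤ (positive⁻¹ 1ℚ) (toℚ-mono-≤ m≤k))

toℚ-cancel-≤ : ∀ {m k} → toℚ m ≤ toℚ k → m ℕ.≤ k
toℚ-cancel-≤ {m} {k} toℚm≤toℚk with ℕ.≤-<-connex m k
... | inj₁ m≤k = m≤k
... | inj₂ k<m = contradiction (≤-<-trans toℚm≤toℚk (toℚ-mono-< k<m)) (<-irrefl refl)

toℚ-injective : ∀ {m k} → toℚ m ≡ toℚ k → m ≡ k
toℚ-injective eq = ℕ.≤-antisym (toℚ-cancel-≤ (≤-reflexive eq)) (toℚ-cancel-≤ (≤-reflexive (sym eq)))

ratio*toℚ : ∀ k → ratio (suc k) * toℚ (suc k) ≡ toℚ k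
ratio*toℚ k = trans (sym (fromℚᵘ-homo-* r′ k+1′)) (fromℚᵘ-cong {r′ ℚᵘ.* k+1′} {ℚᵘ.mkℚᵘ (ℤ.+ k) 0} (ℚᵘ.*≡* cross))
  where
  r′   = ℚᵘ.mkℚᵘ (ℤ.+ k) k
  k+1′ = ℚᵘ.mkℚᵘ (ℤ.+ suc k) 0
  cross : (ℤ.+ k ℤ.* ℤ.+ suc k) ℤ.* ℤ.+ 1 ≡ ℤ.+ k ℤ.* ℤ.+ (suc k ℕ.* 1)
  cross = identity (ℤ.+ k)
    where identity : ∀ a → (a ℤ.* (ℤ.+ 1 ℤ.+ a)) ℤ.* ℤ.+ 1 ≡ a ℤ.* ((ℤ.+ 1 ℤ.+ a) ℤ.* ℤ.+ 1)
          identity = ℤ-Solver.solve-∀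

ratio-nonNeg : ∀ m → 0ℚ ≤ ratio m
ratio-nonNeg zero    = ≤-refl
ratio-nonNeg (suc k) = nonNegative⁻¹ (ratio (suc k)) {{normalize-nonNeg k (suc k)}}

ratio-pos : ∀ k → 0ℚ < ratio (suc (suc k))
ratio-pos k = positive⁻¹ (ratio (suc (suc k))) {{normalize-pos (suc k) (suc (suc k))}}

0<ratio⇒1<m : ∀ m → 0ℚ < ratio m → 1 ℕ.< m
0<ratio⇒1<m zero          0<0 = contradiction 0<0 (<-irrefl refl)
0<ratio⇒1<m (suc zero)    0<0 = contradiction 0<0 (<-irrefl refl)
0<ratio⇒1<m (suc (suc k)) _   = s≤s (s≤s z≤n)

ratio-cross : ∀ k k' → (toℚ (suc k) * toℚ (suc k')) * (ratio (suc k') - ratio (suc k)) ≡ toℚ k' - toℚ k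
ratio-cross k k' = begin
  (a * b) * (r' - r)            ≡⟨ expand a b r r' ⟩
  a * (r' * b) - b * (r * a)    ≡⟨ cong₂ (λ x y → a * x - b * y) (ratio*toℚ k') (ratio*toℚ k) ⟩
  a * K' - b * K                ≡⟨ cong₂ (λ x y → x * K' - y * K) (toℚ-suc k) (toℚ-suc k') ⟩
  (1ℚ + K) * K' - (1ℚ + K') * K ≡⟨ cancel K K' ⟩
  K' - K                        ∎
  where
  open ≡-Reasoning
  a = toℚ (suc k) ; b = toℚ (suc k') ; K = toℚ k ; K' = toℚ k'
  r = ratio (suc k) ; r' = ratio (suc k')
  expand : ∀ a b r r' → (a * b) * (r' - r) ≡ a * (r' * b) - b * (r * a)
  expand = solve-∀ ℚ-ring
  cancel : ∀ K K' → (1ℚ + K) * K' - (1ℚ + K') * K ≡ K' - K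
  cancel = solve-∀ ℚ-ring

ratio-mono-≤ : ∀ {m m'} → m ℕ.≤ m' → ratio m ≤ ratio m'
ratio-mono-≤ {zero}  {m'}     _          = ratio-nonNeg m'
ratio-mono-≤ {suc k} {suc k'} (s≤s k≤k') = 0≤q-p⇒p≤q (0≤p*q⇒0≤q (*-pos (0<toℚ k) (0<toℚ k'))
  (subst (0ℚ ≤_) (sym (ratio-cross k k')) (p≤q⇒0≤q-p (toℚ-mono-≤ k≤k'))))

ratio-mono-< : ∀ {k k'} → k ℕ.< k' → ratio (suc k) < ratio (suc k')
ratio-mono-< {k} {k'} k<k' = 0<q-p⇒p<q (0<p*q⇒0<q (*-pos (0<toℚ k) (0<toℚ k'))
  (subst (0ℚ <_) (sym (ratio-cross k k')) (p<q⇒0<q-p (toℚ-mono-< k<k'))))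

-- Finite sums

sum-mono-≤ : ∀ {n} {f g : Fin n → ℚ} → (∀ i → f i ≤ g i) → sum f ≤ sum g
sum-mono-≤ {zero}  _   = ≤-refl
sum-mono-≤ {suc n} f≤g = +-mono-≤ (f≤g zero) (sum-mono-≤ (λ i → f≤g (suc i)))

sum-nonNeg : ∀ {n} {f : Fin n → ℚ} → (∀ i → 0ℚ ≤ f i) → 0ℚ ≤ sum f
sum-nonNeg {n} {f} 0≤f = subst (_≤ sum f) (sum-replicate-zero n) (sum-mono-≤ {f = λ _ → 0ℚ} 0≤f)

sum-zero : ∀ {n} {f : Fin n → ℚ} → (∀ i → f i ≡ 0ℚ) → sum f ≡ 0ℚ
sum-zero {n} f≡0 = trans (sum-cong-≗ f≡0) (sum-replicate-zero n)

sum-neg : ∀ {n} (f : Fin n → ℚ) → sum (λ i → - f i) ≡ - sum f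
sum-neg {zero}  f = refl
sum-neg {suc n} f = trans (cong (λ s → - f zero + s) (sum-neg (λ i → f (suc i))))
  (sym (neg-distrib-+ (f zero) (sum (λ i → f (suc i)))))

sum-nonNeg-≡0 : ∀ {n} {f : Fin n → ℚ} → (∀ i → 0ℚ ≤ f i) → sum f ≡ 0ℚ → ∀ i → f i ≡ 0ℚ
sum-nonNeg-≡0 {suc n} 0≤f Σf≡0 zero    = p+q≡0⇒p≡0 (0≤f zero) (sum-nonNeg (λ i → 0≤f (suc i))) Σf≡0
sum-nonNeg-≡0 {suc n} 0≤f Σf≡0 (suc i) = sum-nonNeg-≡0 (λ i → 0≤f (suc i))
  (p+q≡0⇒q≡0 (0≤f zero) (sum-nonNeg (λ i → 0≤f (suc i))) Σf≡0) i

term≤sum : ∀ {n} {f : Fin n → ℚ} → (∀ i → 0ℚ ≤ f i) → ∀ i → f i ≤ sum f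
term≤sum {suc n} {f} 0≤f zero    = subst (_≤ sum f) (+-identityʳ (f zero)) (+-monoʳ-≤ (f zero) (sum-nonNeg (λ i → 0≤f (suc i))))
term≤sum {suc n} {f} 0≤f (suc i) = subst (_≤ sum f) (+-identityˡ (f (suc i))) (+-mono-≤ (0≤f zero) (term≤sum (λ i → 0≤f (suc i)) i))

sumℚ≡sum : ∀ {n} (f : Fin n → ℚ) → sumℚ f ≡ sum f
sumℚ≡sum {zero}  f = refl
sumℚ≡sum {suc n} f = cong (λ s → f zero + s) (sumℚ≡sum (λ i → f (suc i)))

-- The cross-term inequality

-- The data of a vertex u outside a clique K with e neighbours and f' + 1 non-neighbours in K: x = a u,
-- and Y, Z are the total weights of those neighbours and non-neighbours; α = ratio |K|, β = ratio (e + 1).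
record CrossBounds (e f' : ℕ) (x Y Z : ℚ) : Set where
  field
    β≤x  : ratio (suc e) ≤ x
    αe≤Y : ratio (e ℕ.+ suc f') * toℚ e ≤ Y
    αf≤Z : ratio (e ℕ.+ suc f') * toℚ (suc f') ≤ Z
    Y≡0  : e ≡ 0 → Y ≡ 0ℚ

crossTerm : ℕ → ℚ → ℚ → ℚ → ℚ
crossTerm e x Y Z = (x + x) * (Y + Z) - x * toℚ e - Y

private
  p+k*a≡p : ∀ p k {a} → a ≡ 0ℚ → p + k * a ≡ p
  p+k*a≡p p k refl = trans (cong (p +_) (*-zeroʳ k)) (+-identityʳ p)

  -- Each ring identity below carries an extra multiple of α-identity or β-identity, which vanishes:
  -- this is how the non-polynomial relations α = (E + F') / (1 + E + F') and β = E / (1 + E) enter.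
  module Decomposition (e f' : ℕ) (x Y Z : ℚ) where
    E F' α β : ℚ
    E  = toℚ e
    F' = toℚ f'
    α  = ratio (e ℕ.+ suc f')
    β  = ratio (suc e)

    α-identity : α * (1ℚ + (E + F')) - (E + F') ≡ 0ℚ
    α-identity = begin
      α * (1ℚ + (E + F')) - (E + F')
        ≡⟨ cong₂ (λ r t → r * t - (E + F')) (cong ratio (ℕ.+-suc e f')) (sym (trans (toℚ-suc (e ℕ.+ f')) (cong (1ℚ +_) (toℚ-+ e f')))) ⟩
      ratio (suc (e ℕ.+ f')) * toℚ (suc (e ℕ.+ f')) - (E + F')  ≡⟨ cong (_- (E + F')) (trans (ratio*toℚ (e ℕ.+ f')) (toℚ-+ e f')) ⟩
      (E + F') - (E + F')                                       ≡⟨ +-inverseʳ (E + F') ⟩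
      0ℚ                                                        ∎
      where open ≡-Reasoning

    β-identity : β * (1ℚ + E) - E ≡ 0ℚ
    β-identity = trans (cong (λ t → β * t - E) (sym (toℚ-suc e))) (trans (cong (_- E) (ratio*toℚ e)) (+-inverseʳ E))

    R : ℚ
    R = β * (E + F' + F') - α * E

    T≡ : crossTerm e x Y Z ≡ (x + x - 1ℚ) * (Y - α * E) + (x + x) * (Z - α * (1ℚ + F'))
                              + (x - β) * (E + F' + F') + R
    T≡ = begin
      crossTerm e x Y Z ≡⟨ identity x Y Z E F' α β ⟩
      (x + x - 1ℚ) * (Y - α * E) + (x + x) * (Z - α * (1ℚ + F')) + (x - β) * (E + F' + F') + R
        + (x + x) * (α * (1ℚ + (E + F')) - (E + F'))
        ≡⟨ p+k*a≡p _ (x + x) α-identity ⟩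
      (x + x - 1ℚ) * (Y - α * E) + (x + x) * (Z - α * (1ℚ + F')) + (x - β) * (E + F' + F') + R ∎
      where
      open ≡-Reasoning
      identity : ∀ x Y Z E F' α β → (x + x) * (Y + Z) - x * E - Y ≡
        (x + x - 1ℚ) * (Y - α * E) + (x + x) * (Z - α * (1ℚ + F')) + (x - β) * (E + F' + F')
        + (β * (E + F' + F') - α * E) + (x + x) * (α * (1ℚ + (E + F')) - (E + F'))
      identity = solve-∀ ℚ-ring

    R≡ : ((1ℚ + E) * (1ℚ + (E + F'))) * R ≡ E * F' * (1ℚ + E + E + F' + F')
    R≡ = begin
      ((1ℚ + E) * (1ℚ + (E + F'))) * R
        ≡⟨ identity E F' α β ⟩
      E * F' * (1ℚ + E + E + F' + F') + (1ℚ + (E + F')) * (E + F' + F') * (β * (1ℚ + E) - E)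
        + (- ((1ℚ + E) * E)) * (α * (1ℚ + (E + F')) - (E + F'))
        ≡⟨ p+k*a≡p _ (- ((1ℚ + E) * E)) α-identity ⟩
      E * F' * (1ℚ + E + E + F' + F') + (1ℚ + (E + F')) * (E + F' + F') * (β * (1ℚ + E) - E)
        ≡⟨ p+k*a≡p _ ((1ℚ + (E + F')) * (E + F' + F')) β-identity ⟩
      E * F' * (1ℚ + E + E + F' + F') ∎
      where
      open ≡-Reasoning
      identity : ∀ E F' α β → ((1ℚ + E) * (1ℚ + (E + F'))) * (β * (E + F' + F') - α * E) ≡
        E * F' * (1ℚ + E + E + F' + F') + (1ℚ + (E + F')) * (E + F' + F') * (β * (1ℚ + E) - E)
        + (- ((1ℚ + E) * E)) * (α * (1ℚ + (E + F')) - (E + F'))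
      identity = solve-∀ ℚ-ring

  module WithNeighbours {e' f' : ℕ} {x Y Z : ℚ} (b : CrossBounds (suc e') f' x Y Z) where
    open CrossBounds b
    open Decomposition (suc e') f' x Y Z public

    0≤x : 0ℚ ≤ x
    0≤x = ≤-trans (ratio-nonNeg (suc (suc e'))) β≤x

    0<E : 0ℚ < E
    0<E = 0<toℚ e'

    0<E+F'+F' : 0ℚ < E + F' + F'
    0<E+F'+F' = +-mono-<-≤ (+-mono-<-≤ 0<E (0≤toℚ f')) (0≤toℚ f')

    t₁ t₂ t₃ : ℚ
    t₁ = (x + x - 1ℚ) * (Y - α * E)
    t₂ = (x + x) * (Z - α * (1ℚ + F'))
    t₃ = (x - β) * (E + F' + F')

    0≤t₁ : 0ℚ ≤ t₁
    0≤t₁ = *-nonNeg (p≤q⇒0≤q-p 1≤x+x) (p≤q⇒0≤q-p αe≤Y)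
      where
      ½≤x : ratio 2 ≤ x
      ½≤x = ≤-trans (ratio-mono-≤ {2} {suc (suc e')} (s≤s (s≤s z≤n))) β≤x
      1≤x+x : 1ℚ ≤ x + x
      1≤x+x = +-mono-≤ ½≤x ½≤x

    0≤t₂ : 0ℚ ≤ t₂
    0≤t₂ = *-nonNeg (+-mono-≤ 0≤x 0≤x) (p≤q⇒0≤q-p (subst (λ F → α * F ≤ Z) (toℚ-suc f') αf≤Z))

    0≤t₃ : 0ℚ ≤ t₃
    0≤t₃ = *-nonNeg (p≤q⇒0≤q-p β≤x) (<⇒≤ 0<E+F'+F')

    0<1+E+E+F'+F' : 0ℚ < 1ℚ + E + E + F' + F'
    0<1+E+E+F'+F' = +-mono-<-≤ (+-mono-<-≤ (+-mono-<-≤ (+-mono-<-≤ (positive⁻¹ 1ℚ) (<⇒≤ 0<E)) (<⇒≤ 0<E)) (0≤toℚ f')) (0≤toℚ f')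

    0<[1+E][1+E+F'] : 0ℚ < (1ℚ + E) * (1ℚ + (E + F'))
    0<[1+E][1+E+F'] = subst₂ (λ a b → 0ℚ < a * b) (toℚ-suc (suc e')) (trans (toℚ-suc (suc e' ℕ.+ f')) (cong (1ℚ +_) (toℚ-+ (suc e') f')))
      (*-pos (0<toℚ (suc e')) (0<toℚ (suc e' ℕ.+ f')))

    0≤R : 0ℚ ≤ R
    0≤R = 0≤p*q⇒0≤q 0<[1+E][1+E+F'] (subst (0ℚ ≤_) (sym R≡)
      (*-nonNeg (*-nonNeg (<⇒≤ 0<E) (0≤toℚ f')) (<⇒≤ 0<1+E+E+F'+F')))

  crossTerm-zero : ∀ {f' x Y Z} → CrossBounds 0 f' x Y Z → crossTerm 0 x Y Z ≡ (x + x) * Z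
  crossTerm-zero {x = x} {Y} {Z} b = trans (cong (λ y → (x + x) * (y + Z) - x * 0ℚ - y) (CrossBounds.Y≡0 b refl)) (identity x Z)
    where identity : ∀ x Z → (x + x) * (0ℚ + Z) - x * 0ℚ - 0ℚ ≡ (x + x) * Z
          identity = solve-∀ ℚ-ring

crossTerm-nonNeg : ∀ {e f' x Y Z} → CrossBounds e f' x Y Z → 0ℚ ≤ crossTerm e x Y Z
crossTerm-nonNeg {zero} {f'} {x} {Y} {Z} b = subst (0ℚ ≤_) (sym (crossTerm-zero b)) (*-nonNeg (+-mono-≤ 0≤x 0≤x) 0≤Z)
  where
  open CrossBounds b
  0≤x = ≤-trans (ratio-nonNeg 1) β≤x
  0≤Z = ≤-trans (*-nonNeg (ratio-nonNeg (suc f')) (0≤toℚ (suc f'))) αf≤Z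
crossTerm-nonNeg {suc e'} b = subst (0ℚ ≤_) (sym T≡) (+-mono-≤ (+-mono-≤ (+-mono-≤ 0≤t₁ 0≤t₂) 0≤t₃) 0≤R)
  where open WithNeighbours b

crossTerm≡0 : ∀ {e f' x Y Z} → CrossBounds e f' x Y Z → crossTerm e x Y Z ≡ 0ℚ → 0ℚ < x → 1 ℕ.< e ℕ.+ suc f' →
              f' ≡ 0 × x ≡ ratio (e ℕ.+ suc f')
crossTerm≡0 {zero} {zero} _ _ _ (s≤s ())
crossTerm≡0 {zero} {suc f''} {x} {Y} {Z} b T≡0 0<x _ = contradiction (trans (sym (crossTerm-zero b)) T≡0) (>-irrefl 0<2xZ)
  where
  open CrossBounds b
  0<Z : 0ℚ < Z
  0<Z = <-≤-trans (subst (0ℚ <_) (sym αf≡f'') (0<toℚ f'')) αf≤Z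
    where αf≡f'' = ratio*toℚ (suc f'')
  0<2xZ : 0ℚ < (x + x) * Z
  0<2xZ = *-pos (+-mono-<-≤ 0<x (<⇒≤ 0<x)) 0<Z
  >-irrefl : ∀ {p} → 0ℚ < p → p ≢ 0ℚ
  >-irrefl 0<p p≡0 = <-irrefl (sym p≡0) 0<p
crossTerm≡0 {suc e'} {f'} {x} b T≡0 _ _ = f'≡0 , x≡α
  where
  open WithNeighbours b
  t₁+t₂+t₃+R≡0 : t₁ + t₂ + t₃ + R ≡ 0ℚ
  t₁+t₂+t₃+R≡0 = trans (sym T≡) T≡0
  R≡0 : R ≡ 0ℚ
  R≡0 = p+q≡0⇒q≡0 (+-mono-≤ (+-mono-≤ 0≤t₁ 0≤t₂) 0≤t₃) 0≤R t₁+t₂+t₃+R≡0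
  t₃≡0 : t₃ ≡ 0ℚ
  t₃≡0 = p+q≡0⇒q≡0 (+-mono-≤ 0≤t₁ 0≤t₂) 0≤t₃
    (p+q≡0⇒p≡0 (+-mono-≤ (+-mono-≤ 0≤t₁ 0≤t₂) 0≤t₃) 0≤R t₁+t₂+t₃+R≡0)
  F'≡0 : F' ≡ 0ℚ
  F'≡0 = p*q≡0⇒q≡0 0<E (p*q≡0⇒q≡0 0<1+E+E+F'+F' (begin
    (1ℚ + E + E + F' + F') * (E * F') ≡⟨ *-comm (1ℚ + E + E + F' + F') (E * F') ⟩
    E * F' * (1ℚ + E + E + F' + F')  ≡⟨ sym R≡ ⟩
    ((1ℚ + E) * (1ℚ + (E + F'))) * R ≡⟨ cong (((1ℚ + E) * (1ℚ + (E + F'))) *_) R≡0 ⟩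
    ((1ℚ + E) * (1ℚ + (E + F'))) * 0ℚ ≡⟨ *-zeroʳ ((1ℚ + E) * (1ℚ + (E + F'))) ⟩
    0ℚ ∎))
    where open ≡-Reasoning
  f'≡0 : f' ≡ 0
  f'≡0 = toℚ-injective F'≡0
  x≡β : x ≡ β
  x≡β = p-q≡0⇒p≡q (p*q≡0⇒q≡0 0<E+F'+F' (trans (*-comm (E + F' + F') (x - β)) t₃≡0))
  x≡α : x ≡ ratio (suc e' ℕ.+ suc f')
  x≡α = trans x≡β (cong ratio (sym (trans (cong (λ k → suc e' ℕ.+ suc k) f'≡0) (ℕ.+-comm (suc e') 1))))

-- Vertex sets, counting and cliques

VSet : ℕ → Set
VSet n = Fin n → Bool

χ : Bool → ℚ
χ b = if b then 1ℚ else 0ℚ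

χ-∧ : ∀ a b → χ (a ∧ b) ≡ χ a * χ b
χ-∧ true  b = sym (*-identityˡ (χ b))
χ-∧ false b = sym (*-zeroˡ (χ b))

count : ∀ {n} → VSet n → ℕ
count X = sumℕ (λ i → if X i then 1 else 0)

toℚ-count : ∀ {n} (X : VSet n) → toℚ (count X) ≡ sum (λ i → χ (X i))
toℚ-count {zero}  X = refl
toℚ-count {suc n} X = trans (toℚ-+ (if X zero then 1 else 0) (count (λ i → X (suc i))))
  (cong₂ _+_ (toℚ-χ (X zero)) (toℚ-count (λ i → X (suc i))))
  where toℚ-χ : ∀ b → toℚ (if b then 1 else 0) ≡ χ b
        toℚ-χ true  = refl
        toℚ-χ false = refl

module _ {n : ℕ} where

  ∅ : VSet n
  ∅ _ = false

  _⊆_ : VSet n → VSet n → Set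
  X ⊆ Y = ∀ i → X i ≡ true → Y i ≡ true

  insert : Fin n → VSet n → VSet n
  insert x X i = X i ∨ does (i Fin.≟ x)

  ⁅_⁆ : Fin n → VSet n
  ⁅ x ⁆ = insert x ∅

  insert-∋ : ∀ x X → insert x X x ≡ true
  insert-∋ x X rewrite dec-true (x Fin.≟ x) refl = ∨-zeroʳ (X x)

  insert-⊇ : ∀ {x X i} → X i ≡ true → insert x X i ≡ true
  insert-⊇ Xi rewrite Xi = refl

  insert-elim : ∀ {x X i} → insert x X i ≡ true → X i ≡ true ⊎ i ≡ x
  insert-elim {x} {X} {i} _ with X i | i Fin.≟ x
  ... | true  | _        = inj₁ refl
  ... | false | yes i≡x  = inj₂ i≡x

  ⁅⁆-elim : ∀ {x i} → ⁅ x ⁆ i ≡ true → i ≡ x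
  ⁅⁆-elim {x} {i} h with insert-elim {x} {∅} {i} h
  ... | inj₂ i≡x = i≡x

count-mono : ∀ {n} {X Y : VSet n} → X ⊆ Y → count X ℕ.≤ count Y
count-mono {zero}  _ = z≤n
count-mono {suc n} {X} {Y} X⊆Y = ℕ.+-mono-≤ (indicator-mono (X zero) (Y zero) (X⊆Y zero)) (count-mono (λ i → X⊆Y (suc i)))
  where
  indicator-mono : ∀ a b → (a ≡ true → b ≡ true) → (if a then 1 else 0) ℕ.≤ (if b then 1 else 0)
  indicator-mono false _ _   = z≤n
  indicator-mono true  b a⇒b rewrite a⇒b refl = ℕ.≤-refl

∈⇒0<count : ∀ {n} {X : VSet n} x → X x ≡ true → 0 ℕ.< count X
∈⇒0<count {suc n} {X} zero    Xx rewrite Xx = s≤s z≤n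
∈⇒0<count {suc n} {X} (suc x) Xx = ℕ.≤-trans (∈⇒0<count x Xx) (ℕ.m≤n+m _ (if X zero then 1 else 0))

count-∅ : ∀ {n} {X : VSet n} → (∀ i → X i ≡ false) → count X ≡ 0
count-∅ {zero}  _ = refl
count-∅ {suc n} {X} X≡∅ rewrite X≡∅ zero = count-∅ (λ i → X≡∅ (suc i))

count≡0⇒∉ : ∀ {n} {X : VSet n} → count X ≡ 0 → ∀ i → X i ≡ false
count≡0⇒∉ {X = X} count≡0 i with X i in Xi
... | false = refl
... | true  = contradiction count≡0 (ℕ.>⇒≢ (∈⇒0<count i Xi))

count≤1 : ∀ {n} {X : VSet n} → (∀ i j → X i ≡ true → X j ≡ true → i ≡ j) → count X ℕ.≤ 1
count≤1 {zero}  _ = z≤n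
count≤1 {suc n} {X} unique with X zero in X0
... | true  = ℕ.≤-reflexive (cong suc (count-∅ (λ i → rest i)))
  where
  rest : ∀ i → X (suc i) ≡ false
  rest i with X (suc i) in Xi
  ... | false = refl
  ... | true  with () ← unique zero (suc i) X0 Xi
... | false = count≤1 (λ i j Xi Xj → Fin.suc-injective (unique (suc i) (suc j) Xi Xj))

count≥2 : ∀ {n} {X : VSet n} x y → X x ≡ true → X y ≡ true → x ≢ y → 2 ℕ.≤ count X
count≥2 {suc n}     zero    zero    _  _  x≢y = contradiction refl x≢y
count≥2 {suc n} {X} zero    (suc y) Xx Xy _   rewrite Xx = s≤s (∈⇒0<count y Xy)
count≥2 {suc n} {X} (suc x) zero    Xx Xy _   rewrite Xy = s≤s (∈⇒0<count x Xx)
count≥2 {suc n} {X} (suc x) (suc y) Xx Xy x≢y =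
  ℕ.≤-trans (count≥2 x y Xx Xy (x≢y ∘ cong suc)) (ℕ.m≤n+m _ (if X zero then 1 else 0))

count-split : ∀ {n} (X P : VSet n) → count X ≡ count (λ i → X i ∧ P i) ℕ.+ count (λ i → X i ∧ not (P i))
count-split {zero}  X P = refl
count-split {suc n} X P = trans (cong ((if X zero then 1 else 0) ℕ.+_) (count-split (λ i → X (suc i)) (λ i → P (suc i))))
  (split (X zero) (P zero))
  where
  c₁ = count (λ i → X (suc i) ∧ P (suc i))
  c₂ = count (λ i → X (suc i) ∧ not (P (suc i)))
  split : ∀ a b → (if a then 1 else 0) ℕ.+ (c₁ ℕ.+ c₂)
                ≡ ((if a ∧ b then 1 else 0) ℕ.+ c₁) ℕ.+ ((if a ∧ not b then 1 else 0) ℕ.+ c₂)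
  split false b     = refl
  split true  true  = refl
  split true  false = sym (ℕ.+-suc c₁ c₂)

count-cong : ∀ {n} {X Y : VSet n} → (∀ i → X i ≡ Y i) → count X ≡ count Y
count-cong {zero}  _   = refl
count-cong {suc n} X≗Y = cong₂ (λ b c → (if b then 1 else 0) ℕ.+ c) (X≗Y zero) (count-cong (λ i → X≗Y (suc i)))

count-insert : ∀ {n} {X : VSet n} x → X x ≡ false → count (insert x X) ≡ suc (count X)
count-insert {suc n} {X} zero    Xx rewrite Xx = cong suc (count-cong (λ i → ∨-identityʳ (X (suc i))))
count-insert {suc n} {X} (suc x) Xx rewrite ∨-identityʳ (X zero) =
  trans (cong ((if X zero then 1 else 0) ℕ.+_) (count-insert {X = λ i → X (suc i)} x Xx)) (ℕ.+-suc _ _)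

count-⁅⁆ : ∀ {n} (x : Fin n) → count ⁅ x ⁆ ≡ 1
count-⁅⁆ {n} x = trans (count-insert {X = ∅} x refl) (cong suc (count-∅ {n} {∅} (λ _ → refl)))

module Cliques {n : ℕ} (G : Graph n) where

  _~_ : Fin n → Fin n → Bool
  u ~ w = adj G u w

  ~-sym : ∀ u w → u ~ w ≡ w ~ u
  ~-sym = Graph.sym G

  ~⇒≢ : ∀ {u w} → u ~ w ≡ true → u ≢ w
  ~⇒≢ {u} u~u refl = contradiction (trans (sym u~u) (irrefl G u)) λ ()

  Clique : VSet n → Set
  Clique K = ∀ u w → K u ≡ true → K w ≡ true → u ≢ w → u ~ w ≡ true

  Clique-⊆ : ∀ {K X} → Clique K → X ⊆ K → Clique X
  Clique-⊆ cK X⊆K u w Xu Xw = cK u w (X⊆K u Xu) (X⊆K w Xw)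

  Clique-insert : ∀ {K x} → Clique K → (∀ k → K k ≡ true → k ≢ x → x ~ k ≡ true) → Clique (insert x K)
  Clique-insert {K} {x} cK x~K u w Ku Kw u≢w with insert-elim {x = x} {K} {u} Ku | insert-elim {x = x} {K} {w} Kw
  ... | inj₁ Ku′   | inj₁ Kw′   = cK u w Ku′ Kw′ u≢w
  ... | inj₁ Ku′   | inj₂ refl  = trans (~-sym u w) (x~K u Ku′ u≢w)
  ... | inj₂ refl  | inj₁ Kw′   = x~K w Kw′ (u≢w ∘ sym)
  ... | inj₂ refl  | inj₂ refl  = contradiction refl u≢w

  Clique-⁅⁆ : ∀ x → Clique ⁅ x ⁆
  Clique-⁅⁆ x = Clique-insert {K = ∅} (λ _ _ ()) (λ _ ())

  Clique-pair : ∀ {u w} → u ~ w ≡ true → Clique (insert w ⁅ u ⁆)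
  Clique-pair {u} {w} u~w = Clique-insert (Clique-⁅⁆ u)
    (λ k ⁅u⁆k _ → subst (λ k → w ~ k ≡ true) (sym (⁅⁆-elim ⁅u⁆k)) (trans (~-sym w u) u~w))

  Maximal : VSet n → VSet n → Set
  Maximal U K = ∀ x → U x ≡ true → K x ≡ false → ∃ λ k → K k ≡ true × x ~ k ≡ false

  record MaximalClique (U K : VSet n) : Set where
    field
      members : VSet n
      clique  : Clique members
      ⊇K      : K ⊆ members
      ⊆U      : members ⊆ U
      maximal : Maximal U members

  private
    Candidate : VSet n → VSet n → Fin n → Set
    Candidate U K x = U x ≡ true × K x ≡ false × (∀ k → K k ≡ true → x ~ k ≡ true)

    adjacentToAll? : (K : VSet n) (x : Fin n) → Dec (∀ k → K k ≡ true → x ~ k ≡ true)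
    adjacentToAll? K x = Fin.all? (λ k → (K k Bool.≟ true) →-dec (x ~ k Bool.≟ true))

    noCandidate⇒maximal : ∀ {U K} → (∀ x → ¬ Candidate U K x) → Maximal U K
    noCandidate⇒maximal {U} {K} none x Ux Kx
      with Fin.¬∀⟶∃¬ n _ (λ k → (K k Bool.≟ true) →-dec (x ~ k Bool.≟ true)) (λ x~K → none x (Ux , Kx , x~K))
    ... | k , ¬[Kk⇒x~k] with K k in Kk | x ~ k in x~k
    ...   | true  | false = k , Kk , x~k
    ...   | true  | true  = contradiction (λ _ → refl) ¬[Kk⇒x~k]
    ...   | false | _     = contradiction (λ ()) ¬[Kk⇒x~k]

    extendWithin : ∀ fuel {U K} → count U ℕ.≤ fuel ℕ.+ count K → Clique K → K ⊆ U → MaximalClique U K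
    extendWithin fuel {U} {K} bound cK K⊆U
      with Fin.any? (λ x → (U x Bool.≟ true) ×-dec (K x Bool.≟ false) ×-dec adjacentToAll? K x)
    ... | no ¬candidate = record
      { members = K ; clique = cK ; ⊇K = λ _ Ki → Ki ; ⊆U = K⊆U
      ; maximal = noCandidate⇒maximal (λ x cand → ¬candidate (x , cand)) }
    ... | yes (x , Ux , Kx , x~K) = grow fuel bound
      where
      K⁺ = insert x K
      K⁺⊆U : K⁺ ⊆ U
      K⁺⊆U i K⁺i with insert-elim {x = x} {K} {i} K⁺i
      ... | inj₁ Ki   = K⊆U i Ki
      ... | inj₂ refl = Ux
      grow : ∀ fuel → count U ℕ.≤ fuel ℕ.+ count K → MaximalClique U K
      grow zero bound = contradiction
        (ℕ.≤-trans (ℕ.≤-reflexive (sym (count-insert x Kx))) (ℕ.≤-trans (count-mono K⁺⊆U) bound)) (ℕ.<-irrefl refl)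
      grow (suc fuel) bound = record { MaximalClique M ; ⊇K = λ i Ki → MaximalClique.⊇K M i (insert-⊇ {x = x} {X = K} Ki) }
        where
        M = extendWithin fuel (subst (count U ℕ.≤_) (trans (sym (ℕ.+-suc fuel (count K))) (cong (fuel ℕ.+_) (sym (count-insert x Kx)))) bound)
              (Clique-insert {K = K} {x = x} cK (λ k Kk _ → x~K k Kk)) K⁺⊆U

  extend : ∀ {U K} → Clique K → K ⊆ U → MaximalClique U K
  extend {U} {K} = extendWithin (count U) (ℕ.m≤m+n (count U) (count K))

0<count⇒∈ : ∀ {n} {X : VSet n} → 0 ℕ.< count X → ∃ λ x → X x ≡ true
0<count⇒∈ {n} {X} 0<count with Fin.any? (λ x → X x Bool.≟ true)
... | yes ∃x = ∃x
... | no  ∄x = contradiction (count-∅ (λ x → Bool.¬-not (λ Xx → ∄x (x , Xx)))) (ℕ.>⇒≢ 0<count)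

first : ∀ {n} → VSet n → Maybe (Fin n)
first {zero}  X = nothing
first {suc n} X = if X zero then just zero else Maybe.map suc (first (X ∘ suc))

first-sound : ∀ {n} (X : VSet n) {w} → first X ≡ just w → X w ≡ true
first-sound {suc n} X {w} first≡w with X zero in X0
first-sound {suc n} X {zero}  refl | true = X0
... | false with first (X ∘ suc) in first≡
first-sound {suc n} X {suc w} refl | false | just w = first-sound (X ∘ suc) first≡

first-complete : ∀ {n} (X : VSet n) {w} → X w ≡ true → ∃ λ w′ → first X ≡ just w′
first-complete {suc n} X {w} Xw with X zero in X0
... | true = zero , refl
first-complete {suc n} X {zero}  Xw | false = contradiction (trans (sym Xw) X0) λ ()
first-complete {suc n} X {suc w} Xw | false with first-complete (X ∘ suc) Xw
... | w′ , first≡ rewrite first≡ = suc w′ , refl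

first-cong : ∀ {n} {X Y : VSet n} → (∀ i → X i ≡ Y i) → first X ≡ first Y
first-cong {zero}  _ = refl
first-cong {suc n} {X} {Y} X≗Y rewrite X≗Y zero | first-cong {X = X ∘ suc} {Y ∘ suc} (X≗Y ∘ suc) = refl

-- Weighted sums over vertex sets

sumOver : ∀ {n} → VSet n → (Fin n → ℚ) → ℚ
sumOver X g = sum λ v → χ (X v) * g v

Partition : ∀ {n} → VSet n → VSet n → VSet n → Set
Partition U P K = ∀ v → χ (U v) ≡ χ (P v) + χ (K v)

module _ {n : ℕ} {X : VSet n} where

  χ*-pointwise : ∀ {g h : Fin n → ℚ} → (∀ v → X v ≡ true → g v ≡ h v) → ∀ v → χ (X v) * g v ≡ χ (X v) * h v
  χ*-pointwise {g} {h} g≡h v with X v in Xv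
  ... | true  = cong (1ℚ *_) (g≡h v Xv)
  ... | false = trans (*-zeroˡ (g v)) (sym (*-zeroˡ (h v)))

  χ*-nonNeg : ∀ {g : Fin n → ℚ} → (∀ v → X v ≡ true → 0ℚ ≤ g v) → ∀ v → 0ℚ ≤ χ (X v) * g v
  χ*-nonNeg {g} 0≤g v with X v in Xv
  ... | true  = subst (0ℚ ≤_) (sym (*-identityˡ (g v))) (0≤g v Xv)
  ... | false = ≤-reflexive (sym (*-zeroˡ (g v)))

  sumOver-cong : ∀ {g h} → (∀ v → X v ≡ true → g v ≡ h v) → sumOver X g ≡ sumOver X h
  sumOver-cong g≡h = sum-cong-≗ (χ*-pointwise g≡h)

  sumOver-mono-≤ : ∀ {g h} → (∀ v → X v ≡ true → g v ≤ h v) → sumOver X g ≤ sumOver X h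
  sumOver-mono-≤ {g} {h} g≤h = sum-mono-≤ pointwise
    where
    pointwise : ∀ v → χ (X v) * g v ≤ χ (X v) * h v
    pointwise v with X v in Xv
    ... | true  = subst₂ _≤_ (sym (*-identityˡ (g v))) (sym (*-identityˡ (h v))) (g≤h v Xv)
    ... | false = ≤-reflexive (trans (*-zeroˡ (g v)) (sym (*-zeroˡ (h v))))

  sumOver-nonNeg : ∀ {g} → (∀ v → X v ≡ true → 0ℚ ≤ g v) → 0ℚ ≤ sumOver X g
  sumOver-nonNeg 0≤g = sum-nonNeg (χ*-nonNeg 0≤g)

  sumOver-∅ : ∀ {g} → (∀ v → X v ≡ false) → sumOver X g ≡ 0ℚ
  sumOver-∅ {g} X≡∅ = sum-zero (λ v → trans (cong (λ b → χ b * g v) (X≡∅ v)) (*-zeroˡ (g v)))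

  sumOver-const : ∀ k → sumOver X (λ _ → k) ≡ k * toℚ (count X)
  sumOver-const k = begin
    sum (λ v → χ (X v) * k) ≡⟨ sym (*-distribʳ-sum k (χ ∘ X)) ⟩
    sum (χ ∘ X) * k         ≡⟨ cong (_* k) (sym (toℚ-count X)) ⟩
    toℚ (count X) * k       ≡⟨ *-comm (toℚ (count X)) k ⟩
    k * toℚ (count X)       ∎
    where open ≡-Reasoning

  sumOver-zero : ∀ {g} → (∀ v → X v ≡ true → g v ≡ 0ℚ) → sumOver X g ≡ 0ℚ
  sumOver-zero g≡0 = trans (sumOver-cong g≡0) (trans (sumOver-const 0ℚ) (*-zeroˡ (toℚ (count X))))

  sumOver-lower : ∀ {k g} → (∀ v → X v ≡ true → k ≤ g v) → k * toℚ (count X) ≤ sumOver X g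
  sumOver-lower {k} k≤g = subst (_≤ _) (sumOver-const k) (sumOver-mono-≤ k≤g)

  sumOver-≡0 : ∀ {g} → (∀ v → X v ≡ true → 0ℚ ≤ g v) → sumOver X g ≡ 0ℚ → ∀ v → X v ≡ true → g v ≡ 0ℚ
  sumOver-≡0 {g} 0≤g Σ≡0 v Xv = trans (sym (*-identityˡ (g v)))
    (subst (λ b → χ b * g v ≡ 0ℚ) Xv (sum-nonNeg-≡0 (χ*-nonNeg 0≤g) Σ≡0 v))

  sumOver-∋ : ∀ {g} → (∀ v → X v ≡ true → 0ℚ ≤ g v) → ∀ {v} → X v ≡ true → g v ≤ sumOver X g
  sumOver-∋ {g} 0≤g {v} Xv = subst (_≤ sumOver X g) (trans (cong (λ b → χ b * g v) Xv) (*-identityˡ (g v)))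
    (term≤sum (χ*-nonNeg 0≤g) v)

  sumOver-+ : ∀ g h → sumOver X (λ v → g v + h v) ≡ sumOver X g + sumOver X h
  sumOver-+ g h = trans (sum-cong-≗ (λ v → *-distribˡ-+ (χ (X v)) (g v) (h v))) (∑-distrib-+ (λ v → χ (X v) * g v) (λ v → χ (X v) * h v))

  sumOver-- : ∀ g h → sumOver X (λ v → g v - h v) ≡ sumOver X g - sumOver X h
  sumOver-- g h = begin
    sumOver X (λ v → g v - h v)                     ≡⟨ sumOver-+ g (λ v → - h v) ⟩
    sumOver X g + sumOver X (λ v → - h v)           ≡⟨ cong (sumOver X g +_) (sum-cong-≗ (λ v → sym (neg-distribʳ-* (χ (X v)) (h v)))) ⟩
    sumOver X g + sum (λ v → - (χ (X v) * h v))     ≡⟨ cong (sumOver X g +_) (sum-neg (λ v → χ (X v) * h v)) ⟩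
    sumOver X g - sumOver X h                       ∎
    where
    open ≡-Reasoning

  sumOver-*ʳ : ∀ g k → sumOver X (λ v → g v * k) ≡ sumOver X g * k
  sumOver-*ʳ g k = trans (sum-cong-≗ (λ v → sym (*-assoc (χ (X v)) (g v) k))) (sym (*-distribʳ-sum k (λ v → χ (X v) * g v)))

sumOver-comm : ∀ {n} (X Y : VSet n) (R : Fin n → Fin n → ℚ) →
               sumOver X (λ x → sumOver Y (R x)) ≡ sumOver Y (λ y → sumOver X (λ x → R x y))
sumOver-comm X Y R = begin
  sum (λ x → χ (X x) * sum (λ y → χ (Y y) * R x y))  ≡⟨ sum-cong-≗ (λ x → *-distribˡ-sum (χ (X x)) (λ y → χ (Y y) * R x y)) ⟩
  sum (λ x → sum (λ y → χ (X x) * (χ (Y y) * R x y))) ≡⟨ ∑-comm (λ x y → χ (X x) * (χ (Y y) * R x y)) ⟩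
  sum (λ y → sum (λ x → χ (X x) * (χ (Y y) * R x y))) ≡⟨ sum-cong-≗ (λ y → sum-cong-≗ (λ x → swap (χ (X x)) (χ (Y y)) (R x y))) ⟩
  sum (λ y → sum (λ x → χ (Y y) * (χ (X x) * R x y))) ≡⟨ sum-cong-≗ (λ y → sym (*-distribˡ-sum (χ (Y y)) (λ x → χ (X x) * R x y))) ⟩
  sum (λ y → χ (Y y) * sum (λ x → χ (X x) * R x y))  ∎
  where
  open ≡-Reasoning
  swap : ∀ p q r → p * (q * r) ≡ q * (p * r)
  swap = solve-∀ ℚ-ring

sumOver-partition : ∀ {n} {U P K : VSet n} → Partition U P K → ∀ g → sumOver U g ≡ sumOver P g + sumOver K g
sumOver-partition {U = U} {P} {K} U≡P+K g = trans
  (sum-cong-≗ (λ v → trans (cong (_* g v) (U≡P+K v)) (*-distribʳ-+ (g v) (χ (P v)) (χ (K v)))))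
  (∑-distrib-+ (λ v → χ (P v) * g v) (λ v → χ (K v) * g v))

-- The excess of a vertex set

module Excess {n : ℕ} (G : Graph n) (c : Fin n → ℕ)
  (cliqueBound : ∀ {K v} → Cliques.Clique G K → K v ≡ true → count K ℕ.≤ c v) where

  open Cliques G

  -- With c = cl, weight univ and degWeight univ univ are the right and left sums of the theorem.
  a : Fin n → ℚ
  a v = ratio (c v)

  0≤a : ∀ v → 0ℚ ≤ a v
  0≤a v = ratio-nonNeg (c v)

  ratio≤a : ∀ {K v} → Clique K → K v ≡ true → ratio (count K) ≤ a v
  ratio≤a cK Kv = ratio-mono-≤ (cliqueBound cK Kv)

  weight : VSet n → ℚ
  weight X = sumOver X a

  deg : VSet n → Fin n → ℚ
  deg Y v = sumOver Y (λ w → χ (v ~ w))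

  degWeight : VSet n → VSet n → ℚ
  degWeight X Y = sumOver X (λ v → a v * deg Y v)

  excess : VSet n → ℚ
  excess U = weight U * weight U - degWeight U U

  nbrs : VSet n → Fin n → VSet n
  nbrs K u w = K w ∧ u ~ w

  nonNbrs : VSet n → Fin n → VSet n
  nonNbrs K u w = K w ∧ not (u ~ w)

  crossTermAt : VSet n → Fin n → ℚ
  crossTermAt K u = (a u + a u) * weight K - a u * deg K u - weight (nbrs K u)

  deg≡count : ∀ Y v → deg Y v ≡ toℚ (count (nbrs Y v))
  deg≡count Y v = trans (sum-cong-≗ (λ w → sym (χ-∧ (Y w) (v ~ w)))) (sym (toℚ-count (nbrs Y v)))

  degWeight-partitionʳ : ∀ {U P K} → Partition U P K → ∀ X → degWeight X U ≡ degWeight X P + degWeight X K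
  degWeight-partitionʳ {U} {P} {K} U≡P+K X = begin
    sumOver X (λ v → a v * deg U v)
      ≡⟨ sumOver-cong {X = X} (λ v _ → cong (a v *_) (sumOver-partition {U = U} {P} {K} U≡P+K (λ w → χ (v ~ w)))) ⟩
    sumOver X (λ v → a v * (deg P v + deg K v))
      ≡⟨ sumOver-cong {X = X} (λ v _ → *-distribˡ-+ (a v) (deg P v) (deg K v)) ⟩
    sumOver X (λ v → a v * deg P v + a v * deg K v)
      ≡⟨ sumOver-+ {X = X} (λ v → a v * deg P v) (λ v → a v * deg K v) ⟩
    degWeight X P + degWeight X K
      ∎
    where open ≡-Reasoning

  degWeight-swap : ∀ K P → degWeight K P ≡ sumOver P (λ u → weight (nbrs K u))
  degWeight-swap K P = begin
    sum (λ v → χ (K v) * (a v * sum (λ w → χ (P w) * χ (v ~ w))))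
      ≡⟨ sum-cong-≗ (λ v → distrib (χ (K v)) (a v) (λ w → χ (P w) * χ (v ~ w))) ⟩
    sum (λ v → sum (λ w → term v w))
      ≡⟨ ∑-comm term ⟩
    sum (λ w → sum (λ v → term v w))
      ≡⟨ sum-cong-≗ (λ w → trans (sum-cong-≗ (λ v → rearrange v w)) (sym (*-distribˡ-sum (χ (P w)) (λ v → χ (nbrs K w v) * a v)))) ⟩
    sum (λ w → χ (P w) * weight (nbrs K w))
      ∎
    where
    open ≡-Reasoning
    term : Fin n → Fin n → ℚ
    term v w = χ (K v) * (a v * (χ (P w) * χ (v ~ w)))
    distrib : ∀ x y (f : Fin n → ℚ) → x * (y * sum f) ≡ sum (λ w → x * (y * f w))
    distrib x y f = trans (cong (x *_) (*-distribˡ-sum y f)) (*-distribˡ-sum x (λ w → y * f w))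
    rearrange : ∀ v w → term v w ≡ χ (P w) * (χ (nbrs K w v) * a v)
    rearrange v w rewrite χ-∧ (K v) (w ~ v) | ~-sym v w = identity (χ (K v)) (a v) (χ (P w)) (χ (w ~ v))
      where identity : ∀ k x p q → k * (x * (p * q)) ≡ p * ((k * q) * x)
            identity = solve-∀ ℚ-ring

  crossTerm-sum : ∀ K P → sumOver P (crossTermAt K) ≡ (weight P + weight P) * weight K - degWeight P K - degWeight K P
  crossTerm-sum K P = begin
    sumOver P (crossTermAt K)
      ≡⟨ sumOver-- {X = P} (λ u → (a u + a u) * weight K - a u * deg K u) (λ u → weight (nbrs K u)) ⟩
    sumOver P (λ u → (a u + a u) * weight K - a u * deg K u) - sumOver P (λ u → weight (nbrs K u))
      ≡⟨ cong₂ _-_ (sumOver-- {X = P} (λ u → (a u + a u) * weight K) (λ u → a u * deg K u)) (sym (degWeight-swap K P)) ⟩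
    sumOver P (λ u → (a u + a u) * weight K) - degWeight P K - degWeight K P
      ≡⟨ cong (λ s → s - degWeight P K - degWeight K P)
              (trans (sumOver-*ʳ {X = P} (λ u → a u + a u) (weight K)) (cong (_* weight K) (sumOver-+ {X = P} a a))) ⟩
    (weight P + weight P) * weight K - degWeight P K - degWeight K P ∎
    where open ≡-Reasoning

  excess-partition : ∀ {U P K} → Partition U P K → excess U ≡ excess P + excess K + sumOver P (crossTermAt K)
  excess-partition {U} {P} {K} U≡P+K = begin
    weight U * weight U - degWeight U U
      ≡⟨ cong₂ (λ w d → w * w - d) (sumOver-partition {U = U} {P} {K} U≡P+K a) degWeight≡ ⟩
    (wP + wK) * (wP + wK) - ((dPP + dPK) + (dKP + dKK))
      ≡⟨ identity wP wK dPP dPK dKP dKK ⟩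
    (wP * wP - dPP) + (wK * wK - dKK) + ((wP + wP) * wK - dPK - dKP)
      ≡⟨ cong (excess P + excess K +_) (sym (crossTerm-sum K P)) ⟩
    excess P + excess K + sumOver P (crossTermAt K) ∎
    where
    open ≡-Reasoning
    wP = weight P ; wK = weight K
    dPP = degWeight P P ; dPK = degWeight P K ; dKP = degWeight K P ; dKK = degWeight K K
    degWeight≡ : degWeight U U ≡ (dPP + dPK) + (dKP + dKK)
    degWeight≡ = trans (sumOver-partition {U = U} {P} {K} U≡P+K (λ v → a v * deg U v))
      (cong₂ _+_ (degWeight-partitionʳ {U} {P} {K} U≡P+K P) (degWeight-partitionʳ {U} {P} {K} U≡P+K K))
    identity : ∀ sp sk pp pk kp kk → (sp + sk) * (sp + sk) - ((pp + pk) + (kp + kk)) ≡ (sp * sp - pp) + (sk * sk - kk) + ((sp + sp) * sk - pk - kp)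
    identity = solve-∀ ℚ-ring

  count-nbrs-clique : ∀ {K v} → Clique K → K v ≡ true → count K ≡ suc (count (nbrs K v))
  count-nbrs-clique {K} {v} cK Kv = begin
    count K                                     ≡⟨ count-split K (v ~_) ⟩
    count (nbrs K v) ℕ.+ count (nonNbrs K v)    ≡⟨ cong (count (nbrs K v) ℕ.+_) count-nonNbrs ⟩
    count (nbrs K v) ℕ.+ 1                      ≡⟨ ℕ.+-comm (count (nbrs K v)) 1 ⟩
    suc (count (nbrs K v))                      ∎
    where
    open ≡-Reasoning
    only-v : ∀ w → nonNbrs K v w ≡ true → w ≡ v
    only-v w w∈ with w Fin.≟ v
    ... | yes w≡v = w≡v
    ... | no  w≢v = contradiction (trans (sym (cK v w Kv (∧-conicalˡ _ _ w∈) (w≢v ∘ sym))) (not-injective (∧-conicalʳ _ _ w∈))) λ ()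
    v∈ : nonNbrs K v v ≡ true
    v∈ rewrite Kv | irrefl G v = refl
    count-nonNbrs : count (nonNbrs K v) ≡ 1
    count-nonNbrs = ℕ.≤-antisym (count≤1 (λ i j i∈ j∈ → trans (only-v i i∈) (sym (only-v j j∈)))) (∈⇒0<count v v∈)

  deg-clique : ∀ {K v k} → Clique K → K v ≡ true → count K ≡ suc k → deg K v ≡ toℚ k
  deg-clique {K} {v} cK Kv count≡ = trans (deg≡count K v) (cong toℚ (ℕ.suc-injective (trans (sym (count-nbrs-clique cK Kv)) count≡)))

  weight-clique : ∀ {K k} → Clique K → count K ≡ suc k → toℚ k ≤ weight K
  weight-clique {K} {k} cK count≡ = subst (_≤ weight K) (trans (cong (λ m → ratio m * toℚ m) count≡) (ratio*toℚ k))
    (sumOver-lower {X = K} (λ v Kv → ratio≤a cK Kv))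

  excess-clique : ∀ {K k} → Clique K → count K ≡ suc k → excess K ≡ weight K * (weight K - toℚ k)
  excess-clique {K} {k} cK count≡ = begin
    weight K * weight K - sumOver K (λ v → a v * deg K v) ≡⟨ cong (λ d → weight K * weight K - d) degWeight≡ ⟩
    weight K * weight K - weight K * toℚ k                 ≡⟨ identity (weight K) (toℚ k) ⟩
    weight K * (weight K - toℚ k)                          ∎
    where
    open ≡-Reasoning
    degWeight≡ : sumOver K (λ v → a v * deg K v) ≡ weight K * toℚ k
    degWeight≡ = trans (sumOver-cong {X = K} (λ v Kv → cong (a v *_) (deg-clique cK Kv count≡))) (sumOver-*ʳ {X = K} a (toℚ k))
    identity : ∀ w k → w * w - w * k ≡ w * (w - k)
    identity = solve-∀ ℚ-ring

  0≤excess-clique : ∀ {K k} → Clique K → count K ≡ suc k → 0ℚ ≤ excess K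
  0≤excess-clique {K} {k} cK count≡ = subst (0ℚ ≤_) (sym (excess-clique cK count≡))
    (*-nonNeg (≤-trans (0≤toℚ k) (weight-clique cK count≡)) (p≤q⇒0≤q-p (weight-clique cK count≡)))

  module Outside {K : VSet n} (cK : Clique K) {u k₀ : Fin n} (Ku : K u ≡ false) (Kk₀ : K k₀ ≡ true) (u≁k₀ : u ~ k₀ ≡ false) where

    e f' : ℕ
    e  = count (nbrs K u)
    f' = ℕ.pred (count (nonNbrs K u))

    count-nonNbrs : count (nonNbrs K u) ≡ suc f'
    count-nonNbrs = sym (ℕ.suc-pred _ {{ℕ.>-nonZero (∈⇒0<count k₀ k₀∈)}})
      where k₀∈ : nonNbrs K u k₀ ≡ true
            k₀∈ rewrite Kk₀ | u≁k₀ = refl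

    count-K : count K ≡ e ℕ.+ suc f'
    count-K = trans (count-split K (u ~_)) (cong (e ℕ.+_) count-nonNbrs)

    Y Z : ℚ
    Y = weight (nbrs K u)
    Z = weight (nonNbrs K u)

    partition : Partition K (nbrs K u) (nonNbrs K u)
    partition w with K w | u ~ w
    ... | true  | true  = sym (+-identityʳ 1ℚ)
    ... | true  | false = sym (+-identityˡ 1ℚ)
    ... | false | _     = refl

    crossTermAt≡ : crossTermAt K u ≡ crossTerm e (a u) Y Z
    crossTermAt≡ = cong₂ (λ w d → (a u + a u) * w - a u * d - Y)
      (sumOver-partition {U = K} {nbrs K u} {nonNbrs K u} partition a) (deg≡count K u)

    bounds : CrossBounds e f' (a u) Y Z
    bounds = record
      { β≤x  = subst (λ m → ratio m ≤ a u) count-C (ratio≤a cC (insert-∋ u (nbrs K u)))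
      ; αe≤Y = sumOver-lower {X = nbrs K u} (λ w w∈ → α≤a (∧-conicalˡ _ _ w∈))
      ; αf≤Z = subst (λ m → α * toℚ m ≤ Z) count-nonNbrs (sumOver-lower {X = nonNbrs K u} (λ w w∈ → α≤a (∧-conicalˡ _ _ w∈)))
      ; Y≡0  = λ e≡0 → sumOver-∅ {X = nbrs K u} (count≡0⇒∉ e≡0)
      }
      where
      α = ratio (e ℕ.+ suc f')
      α≤a : ∀ {w} → K w ≡ true → α ≤ a w
      α≤a Kw = subst (λ m → ratio m ≤ _) count-K (ratio≤a cK Kw)
      C = insert u (nbrs K u)
      cC : Clique C
      cC = Clique-insert {K = nbrs K u} {x = u} (Clique-⊆ cK (λ w w∈ → ∧-conicalˡ _ _ w∈)) (λ w w∈ _ → ∧-conicalʳ _ _ w∈)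
      count-C : count C ≡ suc e
      count-C = count-insert u (subst (λ b → b ∧ u ~ u ≡ false) (sym Ku) refl)

    0≤crossTermAt : 0ℚ ≤ crossTermAt K u
    0≤crossTermAt = subst (0ℚ ≤_) (sym crossTermAt≡) (crossTerm-nonNeg bounds)

  module Peel {U K₀ : VSet n} (M : MaximalClique U K₀) {x : Fin n} (Kx : MaximalClique.members M x ≡ true) where
    open MaximalClique M public renaming (members to K; clique to cK)

    P : VSet n
    P v = U v ∧ not (K v)

    partition : Partition U P K
    partition v with U v in Uv | K v in Kv
    ... | true  | true  = sym (+-identityˡ 1ℚ)
    ... | true  | false = sym (+-identityʳ 1ℚ)
    ... | false | true  = contradiction (trans (sym (⊆U v Kv)) Uv) λ ()
    ... | false | false = refl

    P⊆U : P ⊆ U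
    P⊆U v = ∧-conicalˡ _ _

    P⇒∉K : ∀ {u} → P u ≡ true → K u ≡ false
    P⇒∉K Pu = not-injective (∧-conicalʳ _ _ Pu)

    ∈P : ∀ {u} → U u ≡ true → K u ≡ false → P u ≡ true
    ∈P Uu Ku = cong₂ (λ x y → x ∧ not y) Uu Ku

    ∉P⇒K : ∀ {u} → U u ≡ true → P u ≡ false → K u ≡ true
    ∉P⇒K {u} Uu Pu = not-injective (trans (cong (λ b → b ∧ not (K u)) (sym Uu)) Pu)

    count-P<count-U : count P ℕ.< count U
    count-P<count-U = subst (ℕ._≤ count U) (count-insert {X = P} x x∉P) (count-mono insert⊆U)
      where
      x∉P : P x ≡ false
      x∉P rewrite Kx = Bool.∧-zeroʳ (U x)
      insert⊆U : insert x P ⊆ U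
      insert⊆U v v∈ with insert-elim {x = x} {P} {v} v∈
      ... | inj₁ Pv   = P⊆U v Pv
      ... | inj₂ refl = ⊆U x Kx

    k : ℕ
    k = ℕ.pred (count K)

    count-K : count K ≡ suc k
    count-K = sym (ℕ.suc-pred (count K) {{ℕ.>-nonZero (∈⇒0<count x Kx)}})

    missed : ∀ {u} → P u ≡ true → ∃ λ k₀ → K k₀ ≡ true × u ~ k₀ ≡ false
    missed {u} Pu = maximal u (P⊆U u Pu) (P⇒∉K Pu)

    module OutsideAt {u} (Pu : P u ≡ true) =
      Outside cK {u} {proj₁ (missed Pu)} (P⇒∉K Pu) (proj₁ (proj₂ (missed Pu))) (proj₂ (proj₂ (missed Pu)))

    0≤crossTerms : 0ℚ ≤ sumOver P (crossTermAt K)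
    0≤crossTerms = sumOver-nonNeg {X = P} (λ u Pu → OutsideAt.0≤crossTermAt Pu)

    0≤excess-K : 0ℚ ≤ excess K
    0≤excess-K = 0≤excess-clique cK count-K

    excess≡ : excess U ≡ excess P + excess K + sumOver P (crossTermAt K)
    excess≡ = excess-partition {U} {P} {K} partition

  maximalCliqueAt : ∀ {U x} → U x ≡ true → MaximalClique U ⁅ x ⁆
  maximalCliqueAt {U} {x} Ux = extend (Clique-⁅⁆ x) (λ v v∈ → subst (λ w → U w ≡ true) (sym (⁅⁆-elim v∈)) Ux)

  maximalCliqueAt-∋ : ∀ {U x} (Ux : U x ≡ true) → MaximalClique.members (maximalCliqueAt {U} Ux) x ≡ true
  maximalCliqueAt-∋ {U} {x} Ux = MaximalClique.⊇K (maximalCliqueAt {U} Ux) x (insert-∋ x ∅)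

  excess-∅ : ∀ {U} → (∀ v → U v ≡ false) → excess U ≡ 0ℚ
  excess-∅ {U} U≡∅ = cong₂ (λ w d → w * w - d) (sumOver-∅ {X = U} U≡∅) (sumOver-∅ {X = U} U≡∅)

  excess-nonNeg : ∀ U → 0ℚ ≤ excess U
  excess-nonNeg U = go (count U) ℕ.≤-refl
    where
    go : ∀ {U} m → count U ℕ.≤ m → 0ℚ ≤ excess U
    go zero count≤0 = ≤-reflexive (sym (excess-∅ (count≡0⇒∉ (ℕ.n≤0⇒n≡0 count≤0))))
    go {U} (suc m) count≤m with Fin.any? (λ x → U x Bool.≟ true)
    ... | no  ∄x          = ≤-reflexive (sym (excess-∅ (λ x → Bool.¬-not (λ Ux → ∄x (x , Ux)))))
    ... | yes (x , Ux)    = subst (0ℚ ≤_) (sym excess≡)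
      (+-mono-≤ (+-mono-≤ (go m (ℕ.≤-pred (ℕ.≤-trans count-P<count-U count≤m))) 0≤excess-K) 0≤crossTerms)
      where open Peel (maximalCliqueAt {U} Ux) (maximalCliqueAt-∋ {U} Ux)

  ~⇒0<a : ∀ {u w} → u ~ w ≡ true → 0ℚ < a u
  ~⇒0<a {u} {w} u~w = <-≤-trans (ratio-pos 0) (subst (λ m → ratio m ≤ a u) count-pair (ratio≤a (Clique-pair u~w) u∈))
    where
    u∈ : insert w ⁅ u ⁆ u ≡ true
    u∈ = insert-⊇ {x = w} {X = ⁅ u ⁆} {i = u} (insert-∋ u ∅)
    count-pair : count (insert w ⁅ u ⁆) ≡ 2
    count-pair = trans (count-insert {X = ⁅ u ⁆} w w∉) (cong suc (count-⁅⁆ u))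
      where w∉ : ⁅ u ⁆ w ≡ false
            w∉ = dec-false (w Fin.≟ u) (~⇒≢ u~w ∘ sym)

  module ZeroExcessPeel {U K₀ : VSet n} (M : MaximalClique U K₀) {x : Fin n} (Kx : MaximalClique.members M x ≡ true)
                (excess≡0 : excess U ≡ 0ℚ) (0<ax : 0ℚ < a x) where
    open Peel M Kx public

    private
      0≤excess-P+excess-K = +-mono-≤ (excess-nonNeg P) 0≤excess-K
      sum≡0 = trans (sym excess≡) excess≡0

    excess-P≡0 : excess P ≡ 0ℚ
    excess-P≡0 = p+q≡0⇒p≡0 (excess-nonNeg P) 0≤excess-K (p+q≡0⇒p≡0 0≤excess-P+excess-K 0≤crossTerms sum≡0)

    excess-K≡0 : excess K ≡ 0ℚ
    excess-K≡0 = p+q≡0⇒q≡0 (excess-nonNeg P) 0≤excess-K (p+q≡0⇒p≡0 0≤excess-P+excess-K 0≤crossTerms sum≡0)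

    crossTermAt≡0 : ∀ {u} → P u ≡ true → crossTermAt K u ≡ 0ℚ
    crossTermAt≡0 = sumOver-≡0 {X = P} (λ u Pu → OutsideAt.0≤crossTermAt Pu) (p+q≡0⇒q≡0 0≤excess-P+excess-K 0≤crossTerms sum≡0) _

    0<weight-K : 0ℚ < weight K
    0<weight-K = <-≤-trans 0<ax (sumOver-∋ {X = K} (λ v _ → 0≤a v) Kx)

    weight-K≡k : weight K ≡ toℚ k
    weight-K≡k = p-q≡0⇒p≡q (p*q≡0⇒q≡0 0<weight-K (trans (sym (excess-clique cK count-K)) excess-K≡0))

    1<count-K : 1 ℕ.< count K
    1<count-K = subst (1 ℕ.<_) (sym count-K) (s≤s (ℕ.n≢0⇒n>0 k≢0))
      where k≢0 = λ k≡0 → <-irrefl (sym (trans weight-K≡k (cong toℚ k≡0))) 0<weight-K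

    α : ℚ
    α = ratio (count K)

    0<α : 0ℚ < α
    0<α = <-≤-trans (ratio-pos 0) (ratio-mono-≤ {2} {count K} 1<count-K)

    a≡α : ∀ {v} → K v ≡ true → a v ≡ α
    a≡α {v} Kv = p-q≡0⇒p≡q (sumOver-≡0 {X = K} (λ v Kv → p≤q⇒0≤q-p (ratio≤a cK Kv)) Σ≡0 v Kv)
      where
      open ≡-Reasoning
      Σ≡0 : sumOver K (λ v → a v - α) ≡ 0ℚ
      Σ≡0 = begin
        sumOver K (λ v → a v - α)           ≡⟨ sumOver-- {X = K} a (λ _ → α) ⟩
        weight K - sumOver K (λ _ → α)      ≡⟨ cong₂ _-_ weight-K≡k (sumOver-const {X = K} α) ⟩
        toℚ k - α * toℚ (count K)           ≡⟨ cong (λ s → toℚ k - s) (trans (cong (λ m → ratio m * toℚ m) count-K) (ratio*toℚ k)) ⟩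
        toℚ k - toℚ k                       ≡⟨ +-inverseʳ (toℚ k) ⟩
        0ℚ                                  ∎

    module Tight {u} (Pu : P u ≡ true) (0<au : 0ℚ < a u) where
      private module O = OutsideAt Pu

      tight : O.f' ≡ 0 × a u ≡ ratio (O.e ℕ.+ suc O.f')
      tight = crossTerm≡0 O.bounds (trans (sym O.crossTermAt≡) (crossTermAt≡0 Pu)) 0<au (subst (1 ℕ.<_) O.count-K 1<count-K)

      count-nonNbrs≡1 : count (nonNbrs K u) ≡ 1
      count-nonNbrs≡1 = trans O.count-nonNbrs (cong suc (proj₁ tight))

      a-u≡α : a u ≡ α
      a-u≡α = trans (proj₂ tight) (cong ratio (sym O.count-K))

      deg-K≡k : deg K u ≡ toℚ k
      deg-K≡k = trans (deg≡count K u) (cong toℚ (ℕ.suc-injective (begin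
        suc O.e               ≡⟨ ℕ.+-comm 1 O.e ⟩
        O.e ℕ.+ 1             ≡⟨ cong (λ f → O.e ℕ.+ suc f) (sym (proj₁ tight)) ⟩
        O.e ℕ.+ suc O.f'      ≡⟨ sym O.count-K ⟩
        count K               ≡⟨ count-K ⟩
        suc k                 ∎)))
        where open ≡-Reasoning

  -- Otherwise a maximal clique through u ~ w leaves v outside with the two non-neighbours u and w,
  -- whereas a vanishing cross term allows only one.
  nonAdjacent-trans : ∀ {U} → excess U ≡ 0ℚ → ∀ {u v w} → U u ≡ true → U v ≡ true → U w ≡ true →
                      0ℚ < a u → 0ℚ < a v → u ~ v ≡ false → v ~ w ≡ false → u ~ w ≡ false
  nonAdjacent-trans {U} excess≡0 {u} {v} {w} Uu Uv Uw 0<au 0<av u≁v v≁w with u ~ w in u~w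
  ... | false = refl
  ... | true  = contradiction (subst (2 ℕ.≤_) (Tight.count-nonNbrs≡1 Pv 0<av) two-missed) λ { (s≤s ()) }
    where
    pair⊆U : insert w ⁅ u ⁆ ⊆ U
    pair⊆U i i∈ with insert-elim {x = w} {⁅ u ⁆} {i} i∈
    ... | inj₁ i∈⁅u⁆ = subst (λ j → U j ≡ true) (sym (⁅⁆-elim i∈⁅u⁆)) Uu
    ... | inj₂ refl  = Uw
    M = extend (Clique-pair u~w) pair⊆U
    Ku : MaximalClique.members M u ≡ true
    Ku = MaximalClique.⊇K M u (insert-⊇ {x = w} {X = ⁅ u ⁆} {i = u} (insert-∋ u ∅))
    open ZeroExcessPeel M Ku excess≡0 0<au
    Kw : K w ≡ true
    Kw = ⊇K w (insert-∋ w ⁅ u ⁆)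
    Kv : K v ≡ false
    Kv with K v in Kv | v Fin.≟ u
    ... | false | _        = refl
    ... | true  | yes refl = contradiction (trans (sym u~w) v≁w) λ ()
    ... | true  | no v≢u   = contradiction (trans (sym (cK u v Ku Kv (v≢u ∘ sym))) u≁v) λ ()
    Pv : P v ≡ true
    Pv = ∈P Uv Kv
    two-missed : 2 ℕ.≤ count (nonNbrs K v)
    two-missed = count≥2 u w (missed-by-v Ku (trans (~-sym v u) u≁v)) (missed-by-v Kw v≁w) (~⇒≢ u~w)
      where missed-by-v : ∀ {y} → K y ≡ true → v ~ y ≡ false → nonNbrs K v y ≡ true
            missed-by-v Ky v≁y rewrite Ky | v≁y = refl

  sameNbrs : ∀ {U} → excess U ≡ 0ℚ → ∀ {z y} → U z ≡ true → U y ≡ true → 0ℚ < a z → 0ℚ < a y → z ~ y ≡ false →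
             ∀ {w} → U w ≡ true → z ~ w ≡ y ~ w
  sameNbrs excess≡0 {z} {y} Uz Uy 0<az 0<ay z≁y {w} Uw with z ~ w in z~w | y ~ w in y~w
  ... | true  | true  = refl
  ... | false | false = refl
  ... | true  | false = contradiction (trans (sym z~w) (nonAdjacent-trans excess≡0 Uz Uy Uw 0<az 0<ay z≁y y~w)) λ ()
  ... | false | true  = contradiction (trans (sym y~w) (nonAdjacent-trans excess≡0 Uy Uz Uw 0<ay 0<az (trans (~-sym y z) z≁y) z~w)) λ ()

  module ZeroExcessDegrees {U K₀ : VSet n} (M : MaximalClique U K₀) {x : Fin n} (Kx : MaximalClique.members M x ≡ true)
                 (excess≡0 : excess U ≡ 0ℚ) (0<ax : 0ℚ < a x) where
    open ZeroExcessPeel M Kx excess≡0 0<ax public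

    deg-K≡k : ∀ {z} → U z ≡ true → 0ℚ < a z → deg K z ≡ toℚ k
    deg-K≡k {z} Uz 0<az with K z in Kz
    ... | true  = deg-clique cK Kz count-K
    ... | false = Tight.deg-K≡k (∈P Uz Kz) 0<az

    -- Otherwise z extends a maximal clique K₂ of P through q, forcing a z > ratio |K₂| = a q; but a z = a q = α.
    nonNbr-in-P : ∀ {z q} → K z ≡ true → P q ≡ true → 0ℚ < a q → ∃ λ y → P y ≡ true × 0ℚ < a y × z ~ y ≡ false
    nonNbr-in-P {z} {q} Kz Pq 0<aq with Fin.any? (λ y → (K₂ y Bool.≟ true) ×-dec (z ~ y Bool.≟ false))
      where K₂ = MaximalClique.members (maximalCliqueAt {P} Pq)
    ... | yes (y , K₂y , z≁y) = y , M₂.⊆U y K₂y , subst (0ℚ <_) (sym (M₂.a≡α K₂y)) M₂.0<α , z≁y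
      where module M₂ = ZeroExcessPeel (maximalCliqueAt {P} Pq) (maximalCliqueAt-∋ {P} Pq) excess-P≡0 0<aq
    ... | no ∄y = contradiction (<-≤-trans (ratio-mono-< {M₂.k} ℕ.≤-refl) (≤-trans ratio≤a-z (≤-reflexive a-z≡))) (<-irrefl refl)
      where
      module M₂ = ZeroExcessPeel (maximalCliqueAt {P} Pq) (maximalCliqueAt-∋ {P} Pq) excess-P≡0 0<aq
      z~K₂ : ∀ y → M₂.K y ≡ true → z ~ y ≡ true
      z~K₂ y K₂y with z ~ y in z~y
      ... | true  = refl
      ... | false = contradiction (y , K₂y , z~y) ∄y
      z∉K₂ : M₂.K z ≡ false
      z∉K₂ with M₂.K z in K₂z
      ... | false = refl
      ... | true  = contradiction (trans (sym (P⇒∉K (M₂.⊆U z K₂z))) Kz) λ ()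
      ratio≤a-z : ratio (suc (suc M₂.k)) ≤ a z
      ratio≤a-z = subst (λ m → ratio m ≤ a z) (trans (count-insert z z∉K₂) (cong suc M₂.count-K))
        (ratio≤a (Clique-insert {K = M₂.K} {x = z} M₂.cK (λ y K₂y _ → z~K₂ y K₂y)) (insert-∋ z M₂.K))
      a-z≡ : a z ≡ ratio (suc M₂.k)
      a-z≡ = trans (a≡α Kz) (trans (sym (Tight.a-u≡α Pq 0<aq)) (trans (M₂.a≡α (maximalCliqueAt-∋ {P} Pq)) (cong ratio M₂.count-K)))

    -- For z ∈ K the hypothesis on P is reached through a supported non-neighbour y ∈ P, which has the same
    -- neighbours as z since non-adjacency is transitive on the support.
    deg-P-common : (∀ {z z'} → P z ≡ true → P z' ≡ true → 0ℚ < a z → 0ℚ < a z' → deg P z ≡ deg P z') →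
                   ∃ λ δ → ∀ {z} → U z ≡ true → 0ℚ < a z → deg P z ≡ δ
    deg-P-common IH with Fin.any? (λ q → (P q Bool.≟ true) ×-dec (0ℚ <? a q))
    ... | no ∄q = 0ℚ , λ {z} _ _ → sum-zero (no-nbr z)
      where
      no-nbr : ∀ z w → χ (P w) * χ (z ~ w) ≡ 0ℚ
      no-nbr z w with P w in Pw | z ~ w in z~w
      ... | true  | true  = contradiction (w , Pw , ~⇒0<a (trans (~-sym w z) z~w)) ∄q
      ... | true  | false = refl
      ... | false | b     = *-zeroˡ (χ b)
    ... | yes (q , Pq , 0<aq) = deg P q , δ-spec
      where
      δ-spec : ∀ {z} → U z ≡ true → 0ℚ < a z → deg P z ≡ deg P q
      δ-spec {z} Uz 0<az with P z in Pz
      ... | true  = IH Pz Pq 0<az 0<aq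
      ... | false with nonNbr-in-P (∉P⇒K Uz Pz) Pq 0<aq
      ...   | y , Py , 0<ay , z≁y = trans
        (sumOver-cong {X = P} (λ w Pw → cong χ (sameNbrs excess≡0 Uz (P⊆U y Py) 0<az 0<ay z≁y (P⊆U w Pw))))
        (IH Py Pq 0<ay 0<aq)

  deg-regular : ∀ {U} → excess U ≡ 0ℚ → ∀ {x y} → U x ≡ true → U y ≡ true → 0ℚ < a x → 0ℚ < a y → deg U x ≡ deg U y
  deg-regular {U} = go (count U) ℕ.≤-refl
    where
    go : ∀ {U} m → count U ℕ.≤ m → excess U ≡ 0ℚ →
         ∀ {x y} → U x ≡ true → U y ≡ true → 0ℚ < a x → 0ℚ < a y → deg U x ≡ deg U y
    go zero count≤0 _ {x} Ux = contradiction (ℕ.<-≤-trans (∈⇒0<count x Ux) count≤0) λ ()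
    go {U} (suc m) count≤m excess≡0 {x} {y} Ux Uy 0<ax 0<ay = trans (deg≡ Ux 0<ax) (sym (deg≡ Uy 0<ay))
      where
      open ZeroExcessDegrees (maximalCliqueAt {U} Ux) (maximalCliqueAt-∋ {U} Ux) excess≡0 0<ax
      δ = deg-P-common (go m (ℕ.≤-pred (ℕ.≤-trans count-P<count-U count≤m)) excess-P≡0)
      deg≡ : ∀ {z} → U z ≡ true → 0ℚ < a z → deg U z ≡ proj₁ δ + toℚ k
      deg≡ {z} Uz 0<az = trans (sumOver-partition {U = U} {P} {K} partition (λ w → χ (z ~ w)))
        (cong₂ _+_ (proj₂ δ Uz 0<az) (deg-K≡k Uz 0<az))

  univ : VSet n
  univ _ = true

  support : VSet n
  support v = does (0ℚ <? a v)

  support⇒0<a : ∀ {v} → support v ≡ true → 0ℚ < a v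
  support⇒0<a {v} = from-does (0ℚ <? a v)
    where from-does : (d : Dec (0ℚ < a v)) → does d ≡ true → 0ℚ < a v
          from-does (yes 0<av) _ = 0<av

  0<a⇒support : ∀ {v} → 0ℚ < a v → support v ≡ true
  0<a⇒support {v} = dec-true (0ℚ <? a v)

  ∉support⇒a≡0 : ∀ {v} → support v ≡ false → a v ≡ 0ℚ
  ∉support⇒a≡0 {v} = from-does (0ℚ <? a v)
    where from-does : (d : Dec (0ℚ < a v)) → does d ≡ false → a v ≡ 0ℚ
          from-does (no 0≮av) _ = ≤-antisym (≮⇒≥ 0≮av) (0≤a v)

  clique-positive : ∀ {L v} → Clique L → L v ≡ true → 0ℚ < a v → ∀ {z} → L z ≡ true → 0ℚ < a z
  clique-positive {L} {v} cL Lv 0<av {z} Lz with z Fin.≟ v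
  ... | yes refl = 0<av
  ... | no  z≢v  = ~⇒0<a (cL z v Lz Lv z≢v)

  module Converse
    (nonAdj-trans : ∀ {u v w} → 0ℚ < a u → 0ℚ < a v → 0ℚ < a w → u ~ v ≡ false → v ~ w ≡ false → u ~ w ≡ false)
    (regular : ∀ {u v} → 0ℚ < a u → 0ℚ < a v → deg univ u ≡ deg univ v)
    (largest : ∀ v → ∃ λ L → Clique L × L v ≡ true × count L ≡ c v)
    where

    Positive : VSet n → Set
    Positive X = ∀ {v} → X v ≡ true → 0ℚ < a v

    count-nonNbrs≥1 : ∀ {K} → Maximal univ K → ∀ x → 1 ℕ.≤ count (nonNbrs K x)
    count-nonNbrs≥1 {K} maxK x with K x in Kx
    ... | true  = ∈⇒0<count x (cong₂ (λ p q → p ∧ not q) Kx (irrefl G x))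
    ... | false with maxK x refl Kx
    ...   | k , Kk , x≁k = ∈⇒0<count k (cong₂ (λ p q → p ∧ not q) Kk x≁k)

    count-nonNbrs≤1 : ∀ {K} → Clique K → Positive K → ∀ {x} → 0ℚ < a x → count (nonNbrs K x) ℕ.≤ 1
    count-nonNbrs≤1 {K} cK posK {x} 0<ax = count≤1 unique
      where
      unique : ∀ i j → nonNbrs K x i ≡ true → nonNbrs K x j ≡ true → i ≡ j
      unique i j i∈ j∈ with i Fin.≟ j
      ... | yes i≡j = i≡j
      ... | no  i≢j = contradiction
        (trans (sym (cK i j (∧-conicalˡ _ _ i∈) (∧-conicalˡ _ _ j∈) i≢j))
               (nonAdj-trans (posK (∧-conicalˡ _ _ i∈)) 0<ax (posK (∧-conicalˡ _ _ j∈))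
                             (trans (~-sym i x) (not-injective (∧-conicalʳ _ _ i∈))) (not-injective (∧-conicalʳ _ _ j∈))))
        λ ()

    double-count : ∀ X Y → sumOver X (λ x → toℚ (count (nonNbrs Y x))) ≡ sumOver Y (λ y → toℚ (count (nonNbrs X y)))
    double-count X Y = begin
      sumOver X (λ x → toℚ (count (nonNbrs Y x)))
        ≡⟨ sumOver-cong {X = X} (λ x _ → as-sum Y x) ⟩
      sumOver X (λ x → sumOver Y (λ y → χ (not (x ~ y))))
        ≡⟨ sumOver-comm X Y (λ x y → χ (not (x ~ y))) ⟩
      sumOver Y (λ y → sumOver X (λ x → χ (not (x ~ y))))
        ≡⟨ sumOver-cong {X = Y} (λ y _ → sumOver-cong {X = X} (λ x _ → cong (χ ∘ not) (~-sym x y))) ⟩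
      sumOver Y (λ y → sumOver X (λ x → χ (not (y ~ x))))
        ≡⟨ sumOver-cong {X = Y} (λ y _ → sym (as-sum X y)) ⟩
      sumOver Y (λ y → toℚ (count (nonNbrs X y)))
        ∎
      where
      open ≡-Reasoning
      as-sum : ∀ Z z → toℚ (count (nonNbrs Z z)) ≡ sumOver Z (λ w → χ (not (z ~ w)))
      as-sum Z z = trans (toℚ-count (nonNbrs Z z)) (sum-cong-≗ (λ w → χ-∧ (Z w) (not (z ~ w))))

    count≡sumOver : ∀ (X : VSet n) → toℚ (count X) ≡ sumOver X (λ _ → 1ℚ)
    count≡sumOver X = sym (trans (sumOver-const {X = X} 1ℚ) (*-identityˡ (toℚ (count X))))

    -- Double count the non-adjacent pairs in L × K: each x ∈ L misses some k ∈ K as K is maximal, and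
    -- no k is missed twice as non-adjacency is transitive on the support.
    clique≤maximal : ∀ {L K} → Clique L → Positive L → Clique K → Maximal univ K → Positive K → count L ℕ.≤ count K
    clique≤maximal {L} {K} cL posL cK maxK posK = toℚ-cancel-≤ (begin
      toℚ (count L)                                   ≡⟨ count≡sumOver L ⟩
      sumOver L (λ _ → 1ℚ)                             ≤⟨ step₁ ⟩
      sumOver L (λ x → toℚ (count (nonNbrs K x)))     ≡⟨ double-count L K ⟩
      sumOver K (λ k → toℚ (count (nonNbrs L k)))     ≤⟨ step₂ ⟩
      sumOver K (λ _ → 1ℚ)                             ≡⟨ count≡sumOver K ⟨
      toℚ (count K)                                   ∎)
      where
      open ≤-Reasoning
      step₁ : sumOver L (λ _ → 1ℚ) ≤ sumOver L (λ x → toℚ (count (nonNbrs K x)))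
      step₁ = sumOver-mono-≤ {X = L} (λ x _ → toℚ-mono-≤ {1} (count-nonNbrs≥1 maxK x))
      step₂ : sumOver K (λ k → toℚ (count (nonNbrs L k))) ≤ sumOver K (λ _ → 1ℚ)
      step₂ = sumOver-mono-≤ {X = K} (λ k Kk → toℚ-mono-≤ {k = 1} (count-nonNbrs≤1 cL posL (posK Kk)))

    module AtSupport {p : Fin n} (0<ap : 0ℚ < a p) where
      M = maximalCliqueAt {univ} {p} refl
      open MaximalClique M renaming (members to K; clique to cK)

      Kp : K p ≡ true
      Kp = maximalCliqueAt-∋ {univ} refl

      posK : Positive K
      posK = clique-positive cK Kp 0<ap

      α : ℚ
      α = ratio (count K)

      a≡α : ∀ {v} → 0ℚ < a v → a v ≡ α
      a≡α {v} 0<av = ≤-antisym (ratio-mono-≤ c≤count-K) (ratio-mono-≤ count-K≤c)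
        where
        L = proj₁ (largest v)
        cL = proj₁ (proj₂ (largest v))
        Lv = proj₁ (proj₂ (proj₂ (largest v)))
        c≤count-K : c v ℕ.≤ count K
        c≤count-K = subst (ℕ._≤ count K) (proj₂ (proj₂ (proj₂ (largest v)))) (clique≤maximal cL (clique-positive cL Lv 0<av) cK maximal posK)
        Mv = maximalCliqueAt {univ} {v} refl
        Mv∋v = maximalCliqueAt-∋ {univ} {v} refl
        count-K≤c : count K ℕ.≤ c v
        count-K≤c = ℕ.≤-trans
          (clique≤maximal cK posK (MaximalClique.clique Mv) (MaximalClique.maximal Mv) (clique-positive (MaximalClique.clique Mv) Mv∋v 0<av))
          (cliqueBound (MaximalClique.clique Mv) Mv∋v)

      count-nonNbrs≡1 : ∀ {x} → 0ℚ < a x → count (nonNbrs K x) ≡ 1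
      count-nonNbrs≡1 {x} 0<ax = ℕ.≤-antisym (count-nonNbrs≤1 cK posK 0<ax) (count-nonNbrs≥1 maximal x)

      N d : ℚ
      N = toℚ (count support)
      d = deg univ p

      count-nonNbrs-support : ∀ {k} → K k ≡ true → toℚ (count (nonNbrs support k)) ≡ N - d
      count-nonNbrs-support {k} Kk = begin
        toℚ (count (nonNbrs support k))           ≡⟨ identity (toℚ (count (nbrs support k))) (toℚ (count (nonNbrs support k))) ⟩
        (toℚ (count (nbrs support k)) + toℚ (count (nonNbrs support k))) - toℚ (count (nbrs support k))
          ≡⟨ cong₂ _-_ (sym (trans (cong toℚ (count-split support (k ~_))) (toℚ-+ (count (nbrs support k)) (count (nonNbrs support k))))) deg≡d ⟩
        N - d                                     ∎
        where
        open ≡-Reasoning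
        identity : ∀ x y → y ≡ (x + y) - x
        identity = solve-∀ ℚ-ring
        nbrs-support : ∀ w → nbrs support k w ≡ nbrs univ k w
        nbrs-support w with k ~ w in k~w
        ... | true  = cong (_∧ true) (0<a⇒support (~⇒0<a (trans (~-sym w k) k~w)))
        ... | false = Bool.∧-zeroʳ (support w)
        deg≡d : toℚ (count (nbrs support k)) ≡ d
        deg≡d = trans (cong toℚ (count-cong nbrs-support)) (trans (sym (deg≡count univ k)) (regular (posK Kk) 0<ap))

      -- Double count the non-adjacent pairs in support × K: each supported vertex misses exactly one
      -- vertex of K, and each k ∈ K misses the N - d supported vertices that are not its neighbours.
      N≡ : N ≡ (N - d) * toℚ (count K)
      N≡ = begin
        N                                                   ≡⟨ count≡sumOver support ⟩
        sumOver support (λ _ → 1ℚ)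
          ≡⟨ sumOver-cong {X = support} (λ x x∈ → cong toℚ (sym (count-nonNbrs≡1 (support⇒0<a x∈)))) ⟩
        sumOver support (λ x → toℚ (count (nonNbrs K x)))   ≡⟨ double-count support K ⟩
        sumOver K (λ k → toℚ (count (nonNbrs support k)))   ≡⟨ sumOver-cong {X = K} (λ k Kk → count-nonNbrs-support Kk) ⟩
        sumOver K (λ _ → N - d)                             ≡⟨ sumOver-const {X = K} (N - d) ⟩
        (N - d) * toℚ (count K)                             ∎
        where open ≡-Reasoning

      sumOver-univ : ∀ {g h} → (∀ v → 0ℚ < a v → g v ≡ h) → (∀ v → a v ≡ 0ℚ → g v ≡ 0ℚ) → sumOver univ g ≡ h * N
      sumOver-univ {g} {h} on-support off-support = trans (sum-cong-≗ pointwise) (sumOver-const {X = support} h)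
        where
        pointwise : ∀ v → 1ℚ * g v ≡ χ (support v) * h
        pointwise v with support v in v∈
        ... | true  = cong (1ℚ *_) (on-support v (support⇒0<a v∈))
        ... | false = trans (*-identityˡ (g v)) (trans (off-support v (∉support⇒a≡0 v∈)) (sym (*-zeroˡ h)))

      excess≡0 : excess univ ≡ 0ℚ
      excess≡0 = begin
        weight univ * weight univ - degWeight univ univ
          ≡⟨ cong₂ (λ w b → w * w - b) weight≡ degWeight≡ ⟩
        (α * N) * (α * N) - (α * d) * N        ≡⟨ factor α N d ⟩
        (α * N) * (α * N - d)                  ≡⟨ cong ((α * N) *_) αN-d≡0 ⟩
        (α * N) * 0ℚ                           ≡⟨ *-zeroʳ (α * N) ⟩
        0ℚ                                     ∎
        where
        open ≡-Reasoning
        factor : ∀ α N d → (α * N) * (α * N) - (α * d) * N ≡ (α * N) * (α * N - d)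
        factor = solve-∀ ℚ-ring
        weight≡ : weight univ ≡ α * N
        weight≡ = sumOver-univ (λ v 0<av → a≡α 0<av) (λ v av≡0 → av≡0)
        degWeight≡ : degWeight univ univ ≡ (α * d) * N
        degWeight≡ = sumOver-univ (λ v 0<av → cong₂ _*_ (a≡α 0<av) (regular 0<av 0<ap))
                                  (λ v av≡0 → trans (cong (_* deg univ v) av≡0) (*-zeroˡ (deg univ v)))
        k = ℕ.pred (count K)
        count-K : count K ≡ suc k
        count-K = sym (ℕ.suc-pred (count K) {{ℕ.>-nonZero (∈⇒0<count p Kp)}})
        W = toℚ (count K)
        αW≡k : α * W ≡ toℚ k
        αW≡k = trans (cong (λ m → ratio m * toℚ m) count-K) (ratio*toℚ k)
        W≡1+k : W ≡ 1ℚ + toℚ k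
        W≡1+k = trans (cong toℚ count-K) (toℚ-suc k)
        W[αN-d]≡0 : W * (α * N - d) ≡ 0ℚ
        W[αN-d]≡0 = begin
          W * (α * N - d)                   ≡⟨ regroup W α N d ⟩
          (α * W) * N - d * W               ≡⟨ cong₂ (λ x y → x * N - d * y) αW≡k W≡1+k ⟩
          toℚ k * N - d * (1ℚ + toℚ k)      ≡⟨ regroup′ (toℚ k) N d ⟩
          (N - d) * (1ℚ + toℚ k) - N        ≡⟨ cong (λ x → (N - d) * x - N) (sym W≡1+k) ⟩
          (N - d) * W - N                   ≡⟨ cong (_- N) (sym N≡) ⟩
          N - N                             ≡⟨ +-inverseʳ N ⟩
          0ℚ                                ∎
          where
          regroup : ∀ W α N d → W * (α * N - d) ≡ (α * W) * N - d * W
          regroup = solve-∀ ℚ-ring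
          regroup′ : ∀ k N d → k * N - d * (1ℚ + k) ≡ (N - d) * (1ℚ + k) - N
          regroup′ = solve-∀ ℚ-ring
        αN-d≡0 : α * N - d ≡ 0ℚ
        αN-d≡0 = p*q≡0⇒q≡0 (subst (0ℚ <_) (sym (cong toℚ count-K)) (0<toℚ k)) W[αN-d]≡0

    excess-univ≡0 : excess univ ≡ 0ℚ
    excess-univ≡0 with Fin.any? (λ p → 0ℚ <? a p)
    ... | yes (p , 0<ap) = AtSupport.excess≡0 0<ap
    ... | no  ∄p         = cong₂ (λ w b → w * w - b)
      (sumOver-zero {X = univ} (λ v _ → a≡0 v))
      (sumOver-zero {X = univ} (λ v _ → trans (cong (_* deg univ v) (a≡0 v)) (*-zeroˡ (deg univ v))))
      where
      a≡0 : ∀ v → a v ≡ 0ℚ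
      a≡0 v = ≤-antisym (≮⇒≥ (λ 0<av → ∄p (v , 0<av))) (0≤a v)

  module Forward (excess≡0 : excess univ ≡ 0ℚ) where

    nonAdjacent-trans-univ : ∀ {u v w} → 0ℚ < a u → 0ℚ < a v → u ~ v ≡ false → v ~ w ≡ false → u ~ w ≡ false
    nonAdjacent-trans-univ = nonAdjacent-trans excess≡0 refl refl refl

    regular : ∀ {u v} → 0ℚ < a u → 0ℚ < a v → deg univ u ≡ deg univ v
    regular = deg-regular excess≡0 refl refl

    nonNbrs-support : Fin n → VSet n
    nonNbrs-support u w = support w ∧ not (u ~ w)

    -- u is a supported non-neighbour of itself, so on the support part u = part v exactly when u ≁ v.
    part : Fin n → Fin n
    part u = Maybe.fromMaybe u (first (nonNbrs-support u))

    part-spec : ∀ {u} → 0ℚ < a u → ∃ λ w → first (nonNbrs-support u) ≡ just w × part u ≡ w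
    part-spec {u} 0<au with first-complete (nonNbrs-support u) {u} (cong₂ (λ p q → p ∧ not q) (0<a⇒support 0<au) (irrefl G u))
    ... | w , first≡w rewrite first≡w = w , refl , refl

    ~⇔part≢ : ∀ {u v} → 0ℚ < a u → 0ℚ < a v → (u ~ v ≡ true) ⇔ (part u ≢ part v)
    ~⇔part≢ {u} {v} 0<au 0<av = mk⇔ ~⇒part≢ part≢⇒~
      where
      ~⇒part≢ : u ~ v ≡ true → part u ≢ part v
      ~⇒part≢ u~v part≡ with part-spec 0<au | part-spec 0<av
      ... | w , first≡w , refl | w′ , first≡w′ , refl =
        contradiction (trans (sym u~v) (nonAdjacent-trans-univ 0<au (support⇒0<a (∧-conicalˡ _ _ w∈)) u≁w w≁v)) λ ()
        where
        w∈ = first-sound (nonNbrs-support u) first≡w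
        w′∈ = first-sound (nonNbrs-support v) first≡w′
        u≁w : u ~ w ≡ false
        u≁w = not-injective (∧-conicalʳ _ _ w∈)
        w≁v : w ~ v ≡ false
        w≁v = trans (~-sym w v) (subst (λ z → v ~ z ≡ false) (sym part≡) (not-injective (∧-conicalʳ _ _ w′∈)))
      part≢⇒~ : part u ≢ part v → u ~ v ≡ true
      part≢⇒~ part≢ with u ~ v in u~v
      ... | true  = refl
      ... | false = contradiction (trans (proj₂ (proj₂ (part-spec 0<au))) (sym part-v≡)) part≢
        where
        same : ∀ w → nonNbrs-support u w ≡ nonNbrs-support v w
        same w = cong (λ b → support w ∧ not b) (sameNbrs excess≡0 refl refl 0<au 0<av u~v refl)
        part-v≡ : part v ≡ proj₁ (part-spec 0<au)
        part-v≡ = cong (Maybe.fromMaybe v) (trans (sym (first-cong same)) (proj₁ (proj₂ (part-spec 0<au))))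

∣S∣≡count : ∀ {n} (S : Subset n) → ∣ S ∣ ≡ count (lookup S)
∣S∣≡count []          = refl
∣S∣≡count (true ∷ S)  = cong suc (∣S∣≡count S)
∣S∣≡count (false ∷ S) = ∣S∣≡count S

module _ {n : ℕ} (G : Graph n) where
  open Cliques G

  lookup-clique : ∀ {S} → IsClique G S → Clique (lookup S)
  lookup-clique {S} cS u w Su Sw = cS u w (Vec.lookup⇒[]= u S Su) (Vec.lookup⇒[]= w S Sw)

  tabulate-clique : ∀ {K} → Clique K → IsClique G (tabulate K)
  tabulate-clique {K} cK u w u∈ w∈ = cK u w (∈tabulate u∈) (∈tabulate w∈)
    where ∈tabulate : ∀ {v} → v ∈ tabulate K → K v ≡ true
          ∈tabulate {v} v∈ = trans (sym (Vec.lookup∘tabulate K v)) (Vec.[]=⇒lookup v∈)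

  module _ {cl : Fin n → ℕ} (isCl : ∀ v → IsCl G v (cl v)) where

    cliqueBound : ∀ {K v} → Clique K → K v ≡ true → count K ℕ.≤ cl v
    cliqueBound {K} {v} cK Kv = subst (ℕ._≤ cl v) ∣tabulate-K∣≡count
      (proj₂ (isCl v) (tabulate K) (tabulate-clique cK) (Vec.lookup⇒[]= v (tabulate K) (trans (Vec.lookup∘tabulate K v) Kv)))
      where ∣tabulate-K∣≡count = trans (∣S∣≡count (tabulate K)) (count-cong (Vec.lookup∘tabulate K))

    largestClique : ∀ v → ∃ λ L → Clique L × L v ≡ true × count L ≡ cl v
    largestClique v with proj₁ (isCl v)
    ... | S , cS , v∈S , ∣S∣≡cl = lookup S , lookup-clique cS , Vec.[]=⇒lookup v∈S , trans (sym (∣S∣≡count S)) ∣S∣≡cl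

    open Excess G cl cliqueBound

    nonIsolated⇒0<a : ∀ {v} → NonIsolated G v → 0ℚ < a v
    nonIsolated⇒0<a {v} 0<deg = ~⇒0<a (proj₂ (0<count⇒∈ {X = adj G v} 0<deg))

    0<a⇒nonIsolated : ∀ {v} → 0ℚ < a v → NonIsolated G v
    0<a⇒nonIsolated {v} 0<av with largestClique v
    ... | L , cL , Lv , count-L≡cl with Fin.any? (λ w → (L w Bool.≟ true) ×-dec ¬? (w Fin.≟ v))
    ...   | yes (w , Lw , w≢v) = ∈⇒0<count w (cL v w Lv Lw (w≢v ∘ sym))
    ...   | no  ∄w = contradiction (subst (1 ℕ.<_) (sym count-L≡cl) (0<ratio⇒1<m (cl v) 0<av))
                                   (ℕ.≤⇒≯ (count≤1 only-v))
      where
      only-v : ∀ i j → L i ≡ true → L j ≡ true → i ≡ j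
      only-v i j Li Lj = trans (is-v Li) (sym (is-v Lj))
        where is-v : ∀ {k} → L k ≡ true → k ≡ v
              is-v {k} Lk with k Fin.≟ v
              ... | yes k≡v = k≡v
              ... | no  k≢v = contradiction (k , Lk , k≢v) ∄w

    excess≡0⇒structure : excess univ ≡ 0ℚ → CompleteRegularMultipartiteUpToIsolated G
    excess≡0⇒structure excess≡0 =
      n , part , (λ u v u-ni v-ni → ~⇔part≢ (nonIsolated⇒0<a u-ni) (nonIsolated⇒0<a v-ni)) , equal-degrees
      where
      open Forward excess≡0
      equal-degrees : ∀ u v → NonIsolated G u → NonIsolated G v → degree G u ≡ degree G v
      equal-degrees u v u-ni v-ni = toℚ-injective
        (trans (sym (deg≡count univ u)) (trans (regular (nonIsolated⇒0<a u-ni) (nonIsolated⇒0<a v-ni)) (deg≡count univ v)))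

    structure⇒excess≡0 : CompleteRegularMultipartiteUpToIsolated G → excess univ ≡ 0ℚ
    structure⇒excess≡0 (k , part , ~⇔part≢ , equal-degrees) = Converse.excess-univ≡0 nonAdj-trans regular largestClique
      where
      ≁⇒part≡ : ∀ {u v} → 0ℚ < a u → 0ℚ < a v → u ~ v ≡ false → part u ≡ part v
      ≁⇒part≡ {u} {v} 0<au 0<av u≁v with part u Fin.≟ part v
      ... | yes part≡ = part≡
      ... | no  part≢ = contradiction
        (trans (sym u≁v) (Equivalence.from (~⇔part≢ u v (0<a⇒nonIsolated 0<au) (0<a⇒nonIsolated 0<av)) part≢)) λ ()
      nonAdj-trans : ∀ {u v w} → 0ℚ < a u → 0ℚ < a v → 0ℚ < a w → u ~ v ≡ false → v ~ w ≡ false → u ~ w ≡ false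
      nonAdj-trans {u} {v} {w} 0<au 0<av 0<aw u≁v v≁w with u ~ w in u~w
      ... | false = refl
      ... | true  = contradiction (trans (≁⇒part≡ 0<au 0<av u≁v) (≁⇒part≡ 0<av 0<aw v≁w))
                                  (Equivalence.to (~⇔part≢ u w (0<a⇒nonIsolated 0<au) (0<a⇒nonIsolated 0<aw)) u~w)
      regular : ∀ {u v} → 0ℚ < a u → 0ℚ < a v → deg univ u ≡ deg univ v
      regular {u} {v} 0<au 0<av = trans (deg≡count univ u)
        (trans (cong toℚ (equal-degrees u v (0<a⇒nonIsolated 0<au) (0<a⇒nonIsolated 0<av))) (sym (deg≡count univ v)))

    Σratio≡weight : sumℚ (λ v → ratio (cl v)) ≡ weight univ
    Σratio≡weight = trans (sumℚ≡sum (λ v → ratio (cl v))) (sum-cong-≗ (λ v → sym (*-identityˡ (a v))))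

    Σdegree*ratio≡degWeight : sumℚ (λ v → toℚ (degree G v) * ratio (cl v)) ≡ degWeight univ univ
    Σdegree*ratio≡degWeight = trans (sumℚ≡sum (λ v → toℚ (degree G v) * ratio (cl v)))
      (sum-cong-≗ (λ v → trans (*-comm (toℚ (degree G v)) (a v)) (trans (cong (a v *_) (sym (deg≡count univ v))) (sym (*-identityˡ _)))))

theorem1p6 : (n : ℕ) (G : Graph n) (cl : Fin n → ℕ) →
    (∀ v → IsCl G v (cl v)) →
    (sumℚ (λ v → toℚ (degree G v) * ratio (cl v))
       ≤ sumℚ (λ v → ratio (cl v)) * sumℚ (λ v → ratio (cl v)))
    × ((sumℚ (λ v → toℚ (degree G v) * ratio (cl v))
          ≡ sumℚ (λ v → ratio (cl v)) * sumℚ (λ v → ratio (cl v)))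
       ⇔ CompleteRegularMultipartiteUpToIsolated G)
theorem1p6 n G cl isCl =
  inequality , mk⇔ (excess≡0⇒structure G isCl ∘ equality⇒excess≡0) (excess≡0⇒equality ∘ structure⇒excess≡0 G isCl)
  where
  open Excess G cl (cliqueBound G isCl)
  D = sumℚ (λ v → toℚ (degree G v) * ratio (cl v))
  S = sumℚ (λ v → ratio (cl v))
  excess≡S*S-D : excess univ ≡ S * S - D
  excess≡S*S-D = sym (cong₂ (λ s d → s * s - d) (Σratio≡weight G isCl) (Σdegree*ratio≡degWeight G isCl))
  inequality : D ≤ S * S
  inequality = 0≤q-p⇒p≤q (subst (0ℚ ≤_) excess≡S*S-D (excess-nonNeg univ))
  equality⇒excess≡0 : D ≡ S * S → excess univ ≡ 0ℚ
  equality⇒excess≡0 D≡S*S = trans excess≡S*S-D (trans (cong (λ d → S * S - d) D≡S*S) (+-inverseʳ (S * S)))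
  excess≡0⇒equality : excess univ ≡ 0ℚ → D ≡ S * S
  excess≡0⇒equality excess≡0 = sym (p-q≡0⇒p≡q (trans (sym excess≡S*S-D) excess≡0))
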